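{- Let $m\ge 4$ be an integer (so that $S=\{2,m\}$ is admissible). Then $$p(\{2,m\};n)=(m-3)\binom{n-2}{m-1}+(m-2)\binom{n-2}{m-2}-\binom{n-2}{1},$$ i.e. $\#P(\{2,m\};n)=p(\{2,m\};n)\,2^{n-3}$ for all $n\ge m+1$.
   Context: For a permutation $\pi=a_1\ldots a_n$ of $\{1,\ldots,n\}$, an index $i$ is a peak if $a_{i-1}<a_i>a_{i+1}$. $P(S;n)$ is the set of permutations of $\{1,\dots,n\}$ whose set of peaks is exactly $S$. For an admissible finite set $S$ (i.e. $\#P(S;n)\neq 0$ for some $n$), the peak polynomial $p(S;n)$ is the unique polynomial with $\#P(S;n)=p(S;n)2^{n-\#S-1}$ for all $n>\max S$. -}

module Defs where

open import Data.Nat using (ℕ; zero; suc; _+_; _<?_)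
open import Data.Nat.Properties using (_≟_)
open import Data.Bool using (Bool; true; false; _∧_; if_then_else_)
open import Data.List using (List; []; _∷_; map; concatMap; upTo; filter; length)
open import Data.List.Properties using (≡-dec)
open import Data.List.Relation.Unary.Unique.Propositional using (Unique)
open import Data.List.Relation.Unary.Unique.DecPropositional _≟_ using (unique?)
open import Relation.Nullary using (does)
open import Relation.Binary.PropositionalEquality using (_≡_)

oneTo : ℕ → List ℕ
oneTo n = map suc (upTo n)

words : ℕ → ℕ → List (List ℕ)
words n zero    = [] ∷ []
words n (suc k) = concatMap (λ a → map (a ∷_) (words n k)) (oneTo n)

perms : ℕ → List (List ℕ)
perms n = filter unique? (words n n)

-- peaksFrom i w: the (1-based) positions of the peaks of w, where i is the
-- position of the first letter of w.
peaksFrom : ℕ → List ℕ → List ℕ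
peaksFrom i (a ∷ b ∷ c ∷ rest) =
  if does (a <? b) ∧ does (c <? b)
  then suc i ∷ peaksFrom (suc i) (b ∷ c ∷ rest)
  else peaksFrom (suc i) (b ∷ c ∷ rest)
peaksFrom i _ = []

peakSet : List ℕ → List ℕ
peakSet w = peaksFrom 1 w

-- #P(S;n) where S is given as a strictly increasing list.
countPeakSet : List ℕ → ℕ → ℕ
countPeakSet S n = length (filter (λ w → ≡-dec _≟_ (peakSet w) S) (perms n))

module Submission where

-- We count permutations by splitting them at their largest letter.  If w = L ++ M ∷ R with M
-- the maximum, the peaks of w are those of L, the position of M when L and R are both nonempty,
-- and the shifted peaks of R (`peakSet-at-max`).  As only the relative order of the letters of L
-- and of R matters, the count for w is a product of counts for shorter permutations.  To make
-- this precise we work with fresh words (distinct letters of {1,…,n} avoiding a list u):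
-- `∑fresh-split` decomposes them at a free letter, and `standardise` shows, by induction on the
-- number of free letters, that the fresh words of length j with a given peak list number
-- binom (#free u) j · peakCount j, where `peakCount` is the recursion read off from the split.
-- Evaluating the recursion for no peak, one peak and the peaks {2, m}, each by induction on the
-- length, gives the closed form over ℕ with the negative term moved to the other side;
-- `countPeakSet≡peakCount` identifies the count of the statement, and the theorem reads the
-- identity in ℤ.

module PeakCounting where

  open import Defs using (oneTo; words; peaksFrom; peakSet; countPeakSet)
  open import Data.Nat using (ℕ; zero; suc; _+_; _*_; _∸_; _^_; _≤_; _<_; z≤n; s≤s; _≡ᵇ_; _<ᵇ_; _<?_; _!; NonZero)
  open import Data.Nat.Properties
  open import Data.Nat.Combinatorics using (_C_; nCk+nC[k+1]≡[n+1]C[k+1]; k>n⇒nCk≡0; nCn≡1; nCk≡nC[n∸k]; nC1≡n)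
  open import Data.Nat.Tactic.RingSolver using (solve-∀)
  open import Data.Bool using (Bool; true; false; _∧_; _∨_; not; if_then_else_)
  open import Data.Bool.Properties using (∧-assoc; ∧-zeroʳ; ∧-identityʳ; ∨-assoc; ∨-comm; ∨-conicalˡ; ∨-conicalʳ; ∧-conicalˡ; ∧-conicalʳ; not-injective)
  open import Data.List using (List; []; _∷_; map; concatMap; applyUpTo; upTo; _++_; length; filter)
  open import Data.List.Properties using (≡-dec)
  open import Data.List.Relation.Unary.All using (All; []; _∷_; all?) renaming (map to mapAll)
  open import Data.List.Relation.Unary.Unique.DecPropositional _≟_ using (unique?)
  open import Data.Product using (Σ; _×_; _,_)
  open import Data.Sum using (inj₁; inj₂)
  open import Function using (_∘_; id)
  open import Relation.Nullary using (does; yes; no; ¬_; contradiction)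
  open import Relation.Nullary.Decidable using (dec-false; ¬?)
  open import Relation.Unary using (Decidable)
  open import Relation.Binary.Definitions using (Tri; tri<; tri≈; tri>)
  open import Relation.Binary.PropositionalEquality
  open import Data.Integer using (ℤ) renaming (+_ to toℤ; _+_ to _+ℤ_; _-_ to _-ℤ_; _*_ to _*ℤ_)
  open import Data.Integer.Properties using (pos-+; pos-*)
  open import Data.Integer.Tactic.RingSolver using () renaming (solve-∀ to ℤ-solve-∀)
  open import Algebra.Properties.CommutativeSemigroup +-commutativeSemigroup
    using () renaming (interchange to +-interchange; x∙yz≈y∙xz to +-left-swap)
  open import Algebra.Properties.CommutativeSemigroup *-commutativeSemigroup
    using () renaming (interchange to *-interchange; x∙yz≈y∙xz to *-left-swap; xy∙z≈xz∙y to *-right-swap)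

  -- Indicator of a boolean: every count below is a sum of indicators.
  𝟙 : Bool → ℕ
  𝟙 true  = 1
  𝟙 false = 0

  𝟙-∧ : ∀ a b → 𝟙 (a ∧ b) ≡ 𝟙 a * 𝟙 b
  𝟙-∧ true  b = sym (+-identityʳ (𝟙 b))
  𝟙-∧ false b = refl

  𝟙-guard : ∀ c {x y} → (c ≡ true → x ≡ y) → 𝟙 c * x ≡ 𝟙 c * y
  𝟙-guard true  x≡y = cong (1 *_) (x≡y refl)
  𝟙-guard false _   = refl

  ∑ : {A : Set} → List A → (A → ℕ) → ℕ
  ∑ []       f = 0
  ∑ (x ∷ xs) f = f x + ∑ xs f

  ∑-cong : {A : Set} (xs : List A) {f g : A → ℕ} → (∀ x → f x ≡ g x) → ∑ xs f ≡ ∑ xs g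
  ∑-cong []       f≡g = refl
  ∑-cong (x ∷ xs) f≡g = cong₂ _+_ (f≡g x) (∑-cong xs f≡g)

  ∑-zero : {A : Set} (xs : List A) → ∑ xs (λ _ → 0) ≡ 0
  ∑-zero []       = refl
  ∑-zero (x ∷ xs) = ∑-zero xs

  ∑-+ : {A : Set} (xs : List A) (f g : A → ℕ) → ∑ xs (λ x → f x + g x) ≡ ∑ xs f + ∑ xs g
  ∑-+ []       f g = refl
  ∑-+ (x ∷ xs) f g = trans (cong (f x + g x +_) (∑-+ xs f g)) (+-interchange (f x) (g x) _ _)

  ∑-* : {A : Set} (c : ℕ) (xs : List A) (f : A → ℕ) → ∑ xs (λ x → c * f x) ≡ c * ∑ xs f
  ∑-* c []       f = sym (*-zeroʳ c)
  ∑-* c (x ∷ xs) f = trans (cong (c * f x +_) (∑-* c xs f)) (sym (*-distribˡ-+ c (f x) _))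

  ∑-++ : {A : Set} (xs ys : List A) (f : A → ℕ) → ∑ (xs ++ ys) f ≡ ∑ xs f + ∑ ys f
  ∑-++ []       ys f = refl
  ∑-++ (x ∷ xs) ys f = trans (cong (f x +_) (∑-++ xs ys f)) (sym (+-assoc (f x) _ _))

  ∑-map : {A B : Set} (h : A → B) (xs : List A) (f : B → ℕ) → ∑ (map h xs) f ≡ ∑ xs (f ∘ h)
  ∑-map h []       f = refl
  ∑-map h (x ∷ xs) f = cong (f (h x) +_) (∑-map h xs f)

  ∑-concatMap : {A B : Set} (h : A → List B) (xs : List A) (f : B → ℕ) →
    ∑ (concatMap h xs) f ≡ ∑ xs (λ x → ∑ (h x) f)
  ∑-concatMap h []       f = refl
  ∑-concatMap h (x ∷ xs) f =
    trans (∑-++ (h x) (concatMap h xs) f) (cong (∑ (h x) f +_) (∑-concatMap h xs f))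

  ∑< : ℕ → (ℕ → ℕ) → ℕ
  ∑< zero    h = 0
  ∑< (suc n) h = h 0 + ∑< n (h ∘ suc)

  ∑<-cong : ∀ n {f g : ℕ → ℕ} → (∀ i → i < n → f i ≡ g i) → ∑< n f ≡ ∑< n g
  ∑<-cong zero    f≡g = refl
  ∑<-cong (suc n) f≡g = cong₂ _+_ (f≡g 0 (s≤s z≤n)) (∑<-cong n (λ i i<n → f≡g (suc i) (s≤s i<n)))

  ∑<-zero : ∀ n → ∑< n (λ _ → 0) ≡ 0
  ∑<-zero zero    = refl
  ∑<-zero (suc n) = ∑<-zero n

  ∑<-+ : ∀ n (f g : ℕ → ℕ) → ∑< n (λ i → f i + g i) ≡ ∑< n f + ∑< n g
  ∑<-+ zero    f g = refl
  ∑<-+ (suc n) f g =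
    trans (cong (f 0 + g 0 +_) (∑<-+ n (f ∘ suc) (g ∘ suc))) (+-interchange (f 0) (g 0) _ _)

  ∑<-* : ∀ n (c : ℕ) (f : ℕ → ℕ) → ∑< n (λ i → c * f i) ≡ c * ∑< n f
  ∑<-* zero    c f = sym (*-zeroʳ c)
  ∑<-* (suc n) c f = trans (cong (c * f 0 +_) (∑<-* n c (f ∘ suc))) (sym (*-distribˡ-+ c (f 0) _))

  ∑<-last : ∀ n (f : ℕ → ℕ) → ∑< (suc n) f ≡ ∑< n f + f n
  ∑<-last zero    f = +-comm (f 0) 0
  ∑<-last (suc n) f = trans (cong (f 0 +_) (∑<-last n (f ∘ suc))) (sym (+-assoc (f 0) _ _))

  ∑<-single : ∀ n c V → ∑< n (λ i → 𝟙 (i ≡ᵇ c) * V) ≡ 𝟙 (c <ᵇ n) * V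
  ∑<-single zero    c       V = refl
  ∑<-single (suc n) zero    V = trans (cong (V + 0 +_) (∑<-zero n)) (+-identityʳ _)
  ∑<-single (suc n) (suc c) V = ∑<-single n c V

  ∑-applyUpTo : (f : ℕ → ℕ) (n : ℕ) (h : ℕ → ℕ) → ∑ (applyUpTo f n) h ≡ ∑< n (h ∘ f)
  ∑-applyUpTo f zero    h = refl
  ∑-applyUpTo f (suc n) h = cong (h (f 0) +_) (∑-applyUpTo (f ∘ suc) n h)

  ∑-∑< : {A : Set} (xs : List A) (k : ℕ) (F : A → ℕ → ℕ) →
    ∑ xs (λ a → ∑< k (F a)) ≡ ∑< k (λ i → ∑ xs (λ a → F a i))
  ∑-∑< xs zero    F = ∑-zero xs
  ∑-∑< xs (suc k) F =
    trans (∑-+ xs (λ a → F a 0) (λ a → ∑< k (F a ∘ suc)))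
          (cong (∑ xs (λ a → F a 0) +_) (∑-∑< xs k (λ a → F a ∘ suc)))

  ≡ᵇ-refl : ∀ x → (x ≡ᵇ x) ≡ true
  ≡ᵇ-refl zero    = refl
  ≡ᵇ-refl (suc x) = ≡ᵇ-refl x

  ≡ᵇ-sym : ∀ x y → (x ≡ᵇ y) ≡ (y ≡ᵇ x)
  ≡ᵇ-sym zero    zero    = refl
  ≡ᵇ-sym zero    (suc y) = refl
  ≡ᵇ-sym (suc x) zero    = refl
  ≡ᵇ-sym (suc x) (suc y) = ≡ᵇ-sym x y

  ≡ᵇ-true⇒≡ : ∀ x y → (x ≡ᵇ y) ≡ true → x ≡ y
  ≡ᵇ-true⇒≡ zero    zero    _ = refl
  ≡ᵇ-true⇒≡ (suc x) (suc y) e = cong suc (≡ᵇ-true⇒≡ x y e)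

  ≢⇒≡ᵇ-false : ∀ x y → ¬ x ≡ y → (x ≡ᵇ y) ≡ false
  ≢⇒≡ᵇ-false x y x≢y with x ≡ᵇ y in eq
  ... | true  = contradiction (≡ᵇ-true⇒≡ x y eq) x≢y
  ... | false = refl

  <⇒<ᵇ-true : ∀ x y → x < y → (x <ᵇ y) ≡ true
  <⇒<ᵇ-true zero    (suc y) _         = refl
  <⇒<ᵇ-true (suc x) (suc y) (s≤s x<y) = <⇒<ᵇ-true x y x<y

  ≥⇒<ᵇ-false : ∀ x y → y ≤ x → (x <ᵇ y) ≡ false
  ≥⇒<ᵇ-false x       zero    _         = refl
  ≥⇒<ᵇ-false (suc x) (suc y) (s≤s y≤x) = ≥⇒<ᵇ-false x y y≤x

  <ᵇ-true⇒< : ∀ x y → (x <ᵇ y) ≡ true → x < y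
  <ᵇ-true⇒< zero    (suc y) _ = s≤s z≤n
  <ᵇ-true⇒< (suc x) (suc y) e = s≤s (<ᵇ-true⇒< x y e)

  <ᵇ-false⇒≥ : ∀ x y → (x <ᵇ y) ≡ false → y ≤ x
  <ᵇ-false⇒≥ x       zero    _ = z≤n
  <ᵇ-false⇒≥ (suc x) (suc y) e = s≤s (<ᵇ-false⇒≥ x y e)

  binom : ℕ → ℕ → ℕ
  binom n       zero    = 1
  binom zero    (suc k) = 0
  binom (suc n) (suc k) = binom n k + binom n (suc k)

  binom-> : ∀ n k → n < k → binom n k ≡ 0
  binom-> zero    (suc k) _         = refl
  binom-> (suc n) (suc k) (s≤s n<k) = cong₂ _+_ (binom-> n k n<k) (binom-> n (suc k) (m≤n⇒m≤1+n n<k))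

  binom-diag : ∀ n → binom n n ≡ 1
  binom-diag zero    = refl
  binom-diag (suc n) = cong₂ _+_ (binom-diag n) (binom-> n (suc n) ≤-refl)

  binom-1 : ∀ n → binom n 1 ≡ n
  binom-1 zero    = refl
  binom-1 (suc n) = cong suc (binom-1 n)

  binom≡C : ∀ n k → binom n k ≡ n C k
  binom≡C n       zero    = sym (trans (nCk≡nC[n∸k] {k = 0} {n = n} z≤n) (nCn≡1 n))
  binom≡C zero    (suc k) = sym (k>n⇒nCk≡0 {0} {suc k} (s≤s z≤n))
  binom≡C (suc n) (suc k) = trans (cong₂ _+_ (binom≡C n k) (binom≡C n (suc k))) (nCk+nC[k+1]≡[n+1]C[k+1] n k)

  binom-factorial : ∀ m n → binom (m + n) m * (m ! * n !) ≡ (m + n) !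
  binom-factorial zero    n    = trans (+-identityʳ (n ! + 0)) (+-identityʳ (n !))
  binom-factorial (suc m) zero rewrite +-identityʳ m | binom-diag (suc m) = trans (+-identityʳ _) (*-identityʳ _)
  binom-factorial (suc m) (suc n) = begin
      (binom (m + suc n) m + binom (m + suc n) (suc m)) * ((suc m) ! * (suc n) !)
    ≡⟨ *-distribʳ-+ ((suc m) ! * (suc n) !) (binom (m + suc n) m) (binom (m + suc n) (suc m)) ⟩
      binom (m + suc n) m * ((suc m * m !) * (suc n * n !)) + binom (m + suc n) (suc m) * ((suc m * m !) * (suc n * n !))
    ≡⟨ cong₂ _+_ (pull₁ (binom (m + suc n) m) (m !) (n !) (suc m) (suc n))
                 (pull₂ (binom (m + suc n) (suc m)) (m !) (n !) (suc m) (suc n)) ⟩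
      suc m * (binom (m + suc n) m * (m ! * (suc n) !)) + suc n * (binom (m + suc n) (suc m) * ((suc m) ! * n !))
    ≡⟨ cong₂ _+_ (cong (suc m *_) (binom-factorial m (suc n)))
                 (cong (suc n *_) (trans (cong (λ x → binom x (suc m) * ((suc m) ! * n !)) (+-suc m n))
                                         (binom-factorial (suc m) n))) ⟩
      suc m * (m + suc n) ! + suc n * (suc m + n) !
    ≡⟨ cong (λ x → suc m * (m + suc n) ! + suc n * x !) (sym (+-suc m n)) ⟩
      suc m * (m + suc n) ! + suc n * (m + suc n) !
    ≡⟨ sym (*-distribʳ-+ ((m + suc n) !) (suc m) (suc n)) ⟩
      (suc m + suc n) !
    ∎
    where
    open ≡-Reasoning
    pull₁ : ∀ b x y X Y → b * ((X * x) * (Y * y)) ≡ X * (b * (x * (Y * y)))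
    pull₁ = solve-∀
    pull₂ : ∀ b x y X Y → b * ((X * x) * (Y * y)) ≡ Y * (b * ((X * x) * y))
    pull₂ = solve-∀

  -- Both sides count the ways to split p + q + r objects into blocks of sizes p, q and r.
  binom-trinomial : ∀ p q r → binom (p + q + r) p * binom (q + r) q ≡ binom (p + q + r) (p + q) * binom (p + q) p
  binom-trinomial p q r = *-cancelʳ-≡ _ _ (p ! * (q ! * r !)) {{p!q!r!≢0}} (trans byP (sym byPQ))
    where
    open ≡-Reasoning
    instance
      q!r!≢0 : NonZero (q ! * r !)
      q!r!≢0 = q !* r !≢0
    p!q!r!≢0 : NonZero (p ! * (q ! * r !))
    p!q!r!≢0 = m*n≢0 (p !) (q ! * r !) {{p !≢0}}
    A : ℕ
    A = p + q + r
    byP : binom A p * binom (q + r) q * (p ! * (q ! * r !)) ≡ A !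
    byP = begin
        binom A p * binom (q + r) q * (p ! * (q ! * r !))
      ≡⟨ shuffle (binom A p) (binom (q + r) q) (p !) (q ! * r !) ⟩
        binom A p * (p ! * (binom (q + r) q * (q ! * r !)))
      ≡⟨ cong (λ x → binom A p * (p ! * x)) (binom-factorial q r) ⟩
        binom A p * (p ! * (q + r) !)
      ≡⟨ cong (λ x → binom x p * (p ! * (q + r) !)) (+-assoc p q r) ⟩
        binom (p + (q + r)) p * (p ! * (q + r) !)
      ≡⟨ binom-factorial p (q + r) ⟩
        (p + (q + r)) !
      ≡⟨ cong _! (sym (+-assoc p q r)) ⟩
        A !
      ∎
      where
      shuffle : ∀ a b c d → a * b * (c * d) ≡ a * (c * (b * d))
      shuffle = solve-∀
    byPQ : binom A (p + q) * binom (p + q) p * (p ! * (q ! * r !)) ≡ A !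
    byPQ = begin
        binom A (p + q) * binom (p + q) p * (p ! * (q ! * r !))
      ≡⟨ shuffle (binom A (p + q)) (binom (p + q) p) (p !) (q !) (r !) ⟩
        binom A (p + q) * ((binom (p + q) p * (p ! * q !)) * r !)
      ≡⟨ cong (λ x → binom A (p + q) * (x * r !)) (binom-factorial p q) ⟩
        binom A (p + q) * ((p + q) ! * r !)
      ≡⟨ binom-factorial (p + q) r ⟩
        A !
      ∎
      where
      shuffle : ∀ a b c d e → a * b * (c * (d * e)) ≡ a * ((b * (c * d)) * e)
      shuffle = solve-∀

  -- Choosing i of N elements and then k - i of the rest is choosing k and marking i of them.
  binom-subset : ∀ N i k → i ≤ k → binom N i * binom (N ∸ i) (k ∸ i) ≡ binom N k * binom k i
  binom-subset N i k i≤k with k ≤? N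
  ... | yes k≤N = begin
      binom N i * binom (N ∸ i) (k ∸ i)
    ≡⟨ cong₂ (λ x y → binom x i * binom y (k ∸ i)) (sym sizes) (sym rest) ⟩
      binom (i + (k ∸ i) + (N ∸ k)) i * binom ((k ∸ i) + (N ∸ k)) (k ∸ i)
    ≡⟨ binom-trinomial i (k ∸ i) (N ∸ k) ⟩
      binom (i + (k ∸ i) + (N ∸ k)) (i + (k ∸ i)) * binom (i + (k ∸ i)) i
    ≡⟨ cong₂ (λ x y → binom x y * binom y i) sizes (m+[n∸m]≡n i≤k) ⟩
      binom N k * binom k i
    ∎
    where
    open ≡-Reasoning
    sizes : i + (k ∸ i) + (N ∸ k) ≡ N
    sizes = trans (cong (_+ (N ∸ k)) (m+[n∸m]≡n i≤k)) (m+[n∸m]≡n k≤N)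
    rest : (k ∸ i) + (N ∸ k) ≡ N ∸ i
    rest = +-cancelˡ-≡ i _ _ (trans (sym (+-assoc i (k ∸ i) (N ∸ k))) (trans sizes (sym (m+[n∸m]≡n (≤-trans i≤k k≤N)))))
  ... | no k≰N = trans bothZero (sym (cong (_* binom k i) (binom-> N k (≰⇒> k≰N))))
    where
    bothZero : binom N i * binom (N ∸ i) (k ∸ i) ≡ 0
    bothZero with i ≤? N
    ... | yes i≤N = trans (cong (binom N i *_) (binom-> (N ∸ i) (k ∸ i) (∸-monoˡ-< (≰⇒> k≰N) i≤N))) (*-zeroʳ (binom N i))
    ... | no  i≰N = cong (_* binom (N ∸ i) (k ∸ i)) (binom-> N i (≰⇒> i≰N))

  binom-absorption : ∀ N r → suc r * binom N (suc r) + r * binom N r ≡ N * binom N r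
  binom-absorption zero    zero    = refl
  binom-absorption zero    (suc r) = trans (cong₂ _+_ (*-zeroʳ (suc (suc r))) (*-zeroʳ (suc r))) (sym (*-zeroʳ 0))
  binom-absorption (suc N) zero    =
    trans (+-identityʳ _) (trans (+-identityʳ _) (trans (cong suc (binom-1 N)) (sym (*-identityʳ (suc N)))))
  binom-absorption (suc N) (suc r) =
    trans (regroup r (binom N (suc r)) (binom N (suc (suc r))) (binom N r))
          (trans (cong₂ (λ a b → a + (binom N (suc r) + b + binom N r)) (binom-absorption N (suc r)) (binom-absorption N r))
                 (collect N (binom N (suc r)) (binom N r)))
    where
    regroup : ∀ r x y z → suc (suc r) * (x + y) + suc r * (z + x) ≡ (suc (suc r) * y + suc r * x) + (x + (suc r * x + r * z) + z)
    regroup = solve-∀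
    collect : ∀ N x z → N * x + (x + N * z + z) ≡ suc N * (z + x)
    collect = solve-∀

  eqList : List ℕ → List ℕ → Bool
  eqList X S = does (≡-dec _≟_ X S)

  peaks-after-start : ∀ s w → All (s <_) (peaksFrom s w)
  peaks-after-start s []              = []
  peaks-after-start s (a ∷ [])        = []
  peaks-after-start s (a ∷ b ∷ [])    = []
  peaks-after-start s (a ∷ b ∷ c ∷ w) =
    step (does (a <? b) ∧ does (c <? b)) (peaks-after-start (suc s) (b ∷ c ∷ w))
    where
    step : ∀ isPeak {X} → All (suc s <_) X → All (s <_) (if isPeak then suc s ∷ X else X)
    step true  p = ≤-refl ∷ mapAll (<-trans (n<1+n s)) p
    step false p = mapAll (<-trans (n<1+n s)) p

  peaks-before-end : ∀ s w → All (λ x → suc x < length w + s) (peaksFrom s w)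
  peaks-before-end s []              = []
  peaks-before-end s (a ∷ [])        = []
  peaks-before-end s (a ∷ b ∷ [])    = []
  peaks-before-end s (a ∷ b ∷ c ∷ w) =
    step (does (a <? b) ∧ does (c <? b)) (peaks-before-end (suc s) (b ∷ c ∷ w))
    where
    shift : length (b ∷ c ∷ w) + suc s ≡ length (a ∷ b ∷ c ∷ w) + s
    shift = +-suc (length (b ∷ c ∷ w)) s
    step : ∀ isPeak {X} → All (λ x → suc x < length (b ∷ c ∷ w) + suc s) X →
           All (λ x → suc x < length (a ∷ b ∷ c ∷ w) + s) (if isPeak then suc s ∷ X else X)
    step true  p = s≤s (s≤s (s≤s (m≤n+m s (length w)))) ∷ mapAll (λ {x} → subst (suc x <_) shift) p
    step false p = mapAll (λ {x} → subst (suc x <_) shift) p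

  -- In L ++ M ∷ R with M the largest letter, M sits at position t = |L| + s; it is a peak
  -- exactly when L and R are both nonempty.
  apex : ℕ → List ℕ → List ℕ → List ℕ
  apex t []      R       = []
  apex t (_ ∷ _) []      = []
  apex t (_ ∷ _) (_ ∷ _) = t ∷ []

  peaks-max-first : ∀ s M R → All (_< M) R → peaksFrom s (M ∷ R) ≡ peaksFrom (suc s) R
  peaks-max-first s M []           _         = refl
  peaks-max-first s M (r ∷ [])     _         = refl
  peaks-max-first s M (r ∷ r′ ∷ R) (r<M ∷ _) rewrite ≥⇒<ᵇ-false M r (<⇒≤ r<M) = refl

  peaks-around-max₁ : ∀ s a M R → a < M → All (_< M) R →
    peaksFrom s (a ∷ M ∷ R) ≡ apex (suc s) (a ∷ []) R ++ peaksFrom (suc (suc s)) R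
  peaks-around-max₁ s a M []      _   _          = refl
  peaks-around-max₁ s a M (r ∷ R) a<M (r<M ∷ R<M) rewrite <⇒<ᵇ-true a M a<M | <⇒<ᵇ-true r M r<M =
    cong (suc s ∷_) (peaks-max-first (suc s) M (r ∷ R) (r<M ∷ R<M))

  peaks-around-max₂ : ∀ s a b M R → b < M → All (_< M) R →
    peaksFrom s (a ∷ b ∷ M ∷ R) ≡ apex (suc (suc s)) (a ∷ b ∷ []) R ++ peaksFrom (suc (suc (suc s))) R
  peaks-around-max₂ s a b M R b<M R<M rewrite ≥⇒<ᵇ-false M b (<⇒≤ b<M) | ∧-zeroʳ (a <ᵇ b) =
    trans (peaks-around-max₁ (suc s) b M R b<M R<M) (cong (_++ peaksFrom (suc (suc (suc s))) R) (sameApex R))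
    where
    sameApex : ∀ R → apex (suc (suc s)) (b ∷ []) R ≡ apex (suc (suc s)) (a ∷ b ∷ []) R
    sameApex []      = refl
    sameApex (_ ∷ _) = refl

  -- `apex` only sees whether L is empty, so a longer nonempty L with the same apex position gives the same list.
  apex-reindex : ∀ a b c L A R {t t′} → t ≡ t′ →
    A ++ apex t (b ∷ c ∷ L) R ++ peaksFrom (suc t) R ≡ A ++ apex t′ (a ∷ b ∷ c ∷ L) R ++ peaksFrom (suc t′) R
  apex-reindex a b c L A []      refl = refl
  apex-reindex a b c L A (_ ∷ _) refl = refl

  peaks-around-max : ∀ s L M R → All (_< M) L → All (_< M) R →
    peaksFrom s (L ++ M ∷ R) ≡ peaksFrom s L ++ apex (length L + s) L R ++ peaksFrom (suc (length L + s)) R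
  peaks-around-max s []          M R _                   R<M = peaks-max-first s M R R<M
  peaks-around-max s (a ∷ [])    M R (a<M ∷ [])          R<M = peaks-around-max₁ s a M R a<M R<M
  peaks-around-max s (a ∷ b ∷ []) M R (a<M ∷ b<M ∷ [])   R<M = peaks-around-max₂ s a b M R b<M R<M
  peaks-around-max s (a ∷ b ∷ c ∷ L) M R (a<M ∷ L<M) R<M with does (a <? b) ∧ does (c <? b)
  ... | true  = cong (suc s ∷_) (trans (peaks-around-max (suc s) (b ∷ c ∷ L) M R L<M R<M)
                                     (apex-reindex a b c L (peaksFrom (suc s) (b ∷ c ∷ L)) R (+-suc (length (b ∷ c ∷ L)) s)))
  ... | false = trans (peaks-around-max (suc s) (b ∷ c ∷ L) M R L<M R<M)
                      (apex-reindex a b c L (peaksFrom (suc s) (b ∷ c ∷ L)) R (+-suc (length (b ∷ c ∷ L)) s))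

  below : ℕ → List ℕ → List ℕ
  below t []       = []
  below t (x ∷ xs) = if x <ᵇ t then x ∷ below t xs else []

  fromPos : ℕ → List ℕ → List ℕ
  fromPos t []       = []
  fromPos t (x ∷ xs) = if x <ᵇ t then fromPos t xs else x ∷ xs

  eqList-++ : ∀ t A B S → All (_< t) A → All (t ≤_) B →
    eqList (A ++ B) S ≡ eqList A (below t S) ∧ eqList B (fromPos t S)
  eqList-++ t []      B       []      _ _ = refl
  eqList-++ t []      B       (x ∷ S) _ B≥t with x <ᵇ t in x<ᵇt
  eqList-++ t []      []      (x ∷ S) _ _           | true = refl
  eqList-++ t []      (b ∷ B) (x ∷ S) _ (t≤b ∷ _)   | true
    rewrite ≢⇒≡ᵇ-false b x (λ b≡x → <-irrefl (sym b≡x) (<-≤-trans (<ᵇ-true⇒< x t x<ᵇt) t≤b)) = refl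
  ... | false = refl
  eqList-++ t (a ∷ A) B       []      _ _ = refl
  eqList-++ t (a ∷ A) B       (x ∷ S) (a<t ∷ A<t) B≥t with x <ᵇ t in x<ᵇt
  ... | true  = trans (cong (does (a ≟ x) ∧_) (eqList-++ t A B S A<t B≥t)) (sym (∧-assoc (does (a ≟ x)) _ _))
  ... | false rewrite ≢⇒≡ᵇ-false a x (λ a≡x → <-irrefl refl (<-≤-trans a<t (subst (t ≤_) (sym a≡x) (<ᵇ-false⇒≥ x t x<ᵇt)))) = refl

  -- Whether the maximum of a word of length k + 1 is a peak when i letters precede it.
  isApex : ℕ → ℕ → Bool
  isApex zero    k = false
  isApex (suc i) k = suc i <ᵇ k

  apexList : Bool → ℕ → List ℕ
  apexList b t = if b then t ∷ [] else []

  apex-by-lengths : ∀ t L R k → length R ≡ k ∸ length L → apex t L R ≡ apexList (isApex (length L) k) t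
  apex-by-lengths t []      R       k _  = refl
  apex-by-lengths t (x ∷ L) []      k eq rewrite ≥⇒<ᵇ-false (suc (length L)) k (m∸n≡0⇒m≤n (sym eq)) = refl
  apex-by-lengths t (x ∷ L) (r ∷ R) k eq rewrite <⇒<ᵇ-true (suc (length L)) k (m∸n≢0⇒n<m (λ z → 0≢1+n (trans (sym z) (sym eq)))) = refl

  peakSet-at-max : ∀ s S L M R i k → All (_< M) L → All (_< M) R → length L ≡ i → length R ≡ k ∸ i →
    𝟙 (eqList (peaksFrom s (L ++ M ∷ R)) S)
      ≡ 𝟙 (eqList (peaksFrom s L) (below (i + s) S))
        * 𝟙 (eqList (apexList (isApex i k) (i + s) ++ peaksFrom (suc (i + s)) R) (fromPos (i + s) S))
  peakSet-at-max s S L M R i k L<M R<M refl R-len = begin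
      𝟙 (eqList (peaksFrom s (L ++ M ∷ R)) S)
    ≡⟨ cong (λ X → 𝟙 (eqList X S)) (peaks-around-max s L M R L<M R<M) ⟩
      𝟙 (eqList (peaksFrom s L ++ apex t L R ++ peaksFrom (suc t) R) S)
    ≡⟨ cong (λ Y → 𝟙 (eqList (peaksFrom s L ++ Y ++ peaksFrom (suc t) R) S)) apexEq ⟩
      𝟙 (eqList (peaksFrom s L ++ apexList b t ++ peaksFrom (suc t) R) S)
    ≡⟨ cong 𝟙 (eqList-++ t (peaksFrom s L) _ S (mapAll (<-trans (n<1+n _)) (peaks-before-end s L)) (rightAbove b)) ⟩
      𝟙 (eqList (peaksFrom s L) (below t S) ∧ eqList (apexList b t ++ peaksFrom (suc t) R) (fromPos t S))
    ≡⟨ 𝟙-∧ (eqList (peaksFrom s L) (below t S)) _ ⟩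
      𝟙 (eqList (peaksFrom s L) (below t S)) * 𝟙 (eqList (apexList b t ++ peaksFrom (suc t) R) (fromPos t S))
    ∎
    where
    open ≡-Reasoning
    t : ℕ
    t = length L + s
    b : Bool
    b = isApex (length L) k
    apexEq : apex t L R ≡ apexList b t
    apexEq = apex-by-lengths t L R k R-len
    peaksR : All (t ≤_) (peaksFrom (suc t) R)
    peaksR = mapAll (λ t+1<x → <⇒≤ (<-trans (n<1+n t) t+1<x)) (peaks-after-start (suc t) R)
    rightAbove : ∀ present → All (t ≤_) (apexList present t ++ peaksFrom (suc t) R)
    rightAbove true  = ≤-refl ∷ peaksR
    rightAbove false = peaksR

  infix 8 _∈ᵇ_
  infix 4 _≋_

  _∈ᵇ_ : ℕ → List ℕ → Bool
  x ∈ᵇ []       = false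
  x ∈ᵇ (y ∷ ys) = (x ≡ᵇ y) ∨ x ∈ᵇ ys

  ∈ᵇ-++ : ∀ x A B → x ∈ᵇ (A ++ B) ≡ x ∈ᵇ A ∨ x ∈ᵇ B
  ∈ᵇ-++ x []      B = refl
  ∈ᵇ-++ x (a ∷ A) B = trans (cong ((x ≡ᵇ a) ∨_) (∈ᵇ-++ x A B)) (sym (∨-assoc (x ≡ᵇ a) (x ∈ᵇ A) (x ∈ᵇ B)))

  ∉-∷ : ∀ a M u → not (a ∈ᵇ (M ∷ u)) ≡ true → M ∈ᵇ u ≡ false → M ∈ᵇ (a ∷ u) ≡ false
  ∉-∷ a M u a∉ M∉u with a ≡ᵇ M in a≡ᵇM
  ... | false = trans (cong (_∨ M ∈ᵇ u) (trans (≡ᵇ-sym M a) a≡ᵇM)) M∉u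

  fresh : List ℕ → List ℕ → Bool
  fresh u []      = true
  fresh u (a ∷ w) = not (a ∈ᵇ u) ∧ fresh (a ∷ u) w

  fresh-head : ∀ u a w → fresh u (a ∷ w) ≡ true → a ∈ᵇ u ≡ false
  fresh-head u a w ok = not-injective (∧-conicalˡ _ _ ok)

  fresh-tail : ∀ u a w → fresh u (a ∷ w) ≡ true → fresh (a ∷ u) w ≡ true
  fresh-tail u a w ok = ∧-conicalʳ _ _ ok

  fresh-avoids : ∀ u w → fresh u w ≡ true → All (λ x → x ∈ᵇ u ≡ false) w
  fresh-avoids u []      _  = []
  fresh-avoids u (a ∷ w) ok = fresh-head u a w ok ∷ weaken (fresh-avoids (a ∷ u) w (fresh-tail u a w ok))
    where
    weaken : ∀ {w} → All (λ x → x ∈ᵇ (a ∷ u) ≡ false) w → All (λ x → x ∈ᵇ u ≡ false) w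
    weaken []       = []
    weaken (p ∷ ps) = ∨-conicalʳ _ _ p ∷ weaken ps

  record _≋_ (u v : List ℕ) : Set where
    constructor same-members
    field members : ∀ x → x ∈ᵇ u ≡ x ∈ᵇ v
  open _≋_

  ≋-sym : ∀ {u v} → u ≋ v → v ≋ u
  ≋-sym u≋v = same-members λ x → sym (members u≋v x)

  ≋-trans : ∀ {u v w} → u ≋ v → v ≋ w → u ≋ w
  ≋-trans u≋v v≋w = same-members λ x → trans (members u≋v x) (members v≋w x)

  ≋-∷ : ∀ a {u v} → u ≋ v → (a ∷ u) ≋ (a ∷ v)
  ≋-∷ a u≋v = same-members λ x → cong ((x ≡ᵇ a) ∨_) (members u≋v x)

  ≋-++ : ∀ L {u v} → u ≋ v → (L ++ u) ≋ (L ++ v)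
  ≋-++ L {u} {v} u≋v = same-members λ x →
    trans (∈ᵇ-++ x L u) (trans (cong (x ∈ᵇ L ∨_) (members u≋v x)) (sym (∈ᵇ-++ x L v)))

  ≋-move : ∀ a L u → (a ∷ (L ++ u)) ≋ (L ++ a ∷ u)
  ≋-move a L u = same-members λ x → begin
      (x ≡ᵇ a) ∨ x ∈ᵇ (L ++ u)     ≡⟨ cong ((x ≡ᵇ a) ∨_) (∈ᵇ-++ x L u) ⟩
      (x ≡ᵇ a) ∨ (x ∈ᵇ L ∨ x ∈ᵇ u)  ≡⟨ sym (∨-assoc (x ≡ᵇ a) (x ∈ᵇ L) (x ∈ᵇ u)) ⟩
      ((x ≡ᵇ a) ∨ x ∈ᵇ L) ∨ x ∈ᵇ u  ≡⟨ cong (_∨ x ∈ᵇ u) (∨-comm (x ≡ᵇ a) (x ∈ᵇ L)) ⟩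
      (x ∈ᵇ L ∨ (x ≡ᵇ a)) ∨ x ∈ᵇ u  ≡⟨ ∨-assoc (x ∈ᵇ L) (x ≡ᵇ a) (x ∈ᵇ u) ⟩
      x ∈ᵇ L ∨ x ∈ᵇ (a ∷ u)        ≡⟨ sym (∈ᵇ-++ x L (a ∷ u)) ⟩
      x ∈ᵇ (L ++ a ∷ u)            ∎
    where open ≡-Reasoning

  ≋-swap : ∀ a b u → (a ∷ b ∷ u) ≋ (b ∷ a ∷ u)
  ≋-swap a b u = ≋-move a (b ∷ []) u

  fresh-≋ : ∀ {u v} → u ≋ v → ∀ w → fresh u w ≡ fresh v w
  fresh-≋ u≋v []      = refl
  fresh-≋ u≋v (a ∷ w) = cong₂ (λ p q → not p ∧ q) (members u≋v a) (fresh-≋ (≋-∷ a u≋v) w)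

  -- withApex b t D c counts the ways to produce the target list D as "the apex t (present iff b)
  -- followed by a right part", where c D′ counts right parts with peak list D′.
  withApex : Bool → ℕ → List ℕ → (List ℕ → ℕ) → ℕ
  withApex false t D       c = c D
  withApex true  t []      c = 0
  withApex true  t (x ∷ D) c = 𝟙 (t ≡ᵇ x) * c D

  withApex-cong : ∀ b t D {c c′ : List ℕ → ℕ} → (∀ D → c D ≡ c′ D) → withApex b t D c ≡ withApex b t D c′
  withApex-cong false t D       c≡c′ = c≡c′ D
  withApex-cong true  t []      c≡c′ = refl
  withApex-cong true  t (x ∷ D) c≡c′ = cong (𝟙 (t ≡ᵇ x) *_) (c≡c′ D)

  withApex-scale : ∀ b t D c (h : List ℕ → ℕ) → withApex b t D (λ D → c * h D) ≡ c * withApex b t D h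
  withApex-scale false t D       c h = refl
  withApex-scale true  t []      c h = sym (*-zeroʳ c)
  withApex-scale true  t (x ∷ D) c h = *-left-swap (𝟙 (t ≡ᵇ x)) c (h D)

  -- peakCount f j s S: the number of permutations of {1,…,j} whose peaks, with positions
  -- numbered from s, form the list S (this is `peakCount-counts-permutations` below).  It is
  -- defined by splitting a permutation of {1,…,k+1} at its maximum: maxTerm f k s S i counts
  -- those with i letters before the maximum, chosen in binom k i ways, and k - i after it.
  -- The fuel f ≥ j only makes the recursion structural.
  peakCount : ℕ → ℕ → ℕ → List ℕ → ℕ
  maxTerm : ℕ → ℕ → ℕ → List ℕ → ℕ → ℕ

  peakCount f       zero    s S = 𝟙 (eqList [] S)
  peakCount zero    (suc k) s S = 0
  peakCount (suc f) (suc k) s S = ∑< (suc k) (maxTerm f k s S)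

  maxTerm f k s S i =
    binom k i * (peakCount f i s (below (i + s) S)
                 * withApex (isApex i k) (i + s) (fromPos (i + s) S) (peakCount f (k ∸ i) (suc (i + s))))

  module FreshWords (n : ℕ) where

    InRange : ℕ → Set
    InRange x = (1 ≤ x) × (x ≤ n)

    ∑ₙ : (ℕ → ℕ) → ℕ
    ∑ₙ F = ∑ (oneTo n) F

    ∑ₙ-as-range : ∀ F → ∑ₙ F ≡ ∑< n (F ∘ suc)
    ∑ₙ-as-range F = trans (∑-map suc (upTo n) F) (∑-applyUpTo id n (F ∘ suc))

    ∑ₙ-cong : ∀ {F G} → (∀ a → InRange a → F a ≡ G a) → ∑ₙ F ≡ ∑ₙ G
    ∑ₙ-cong {F} {G} F≡G =
      trans (∑ₙ-as-range F) (trans (∑<-cong n (λ i i<n → F≡G (suc i) (s≤s z≤n , i<n))) (sym (∑ₙ-as-range G)))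

    ∑ₙ-single : ∀ M → InRange M → (F : ℕ → ℕ) → ∑ₙ (λ a → 𝟙 (a ≡ᵇ M) * F a) ≡ F M
    ∑ₙ-single (suc M) (_ , M<n) F = begin
        ∑ₙ (λ a → 𝟙 (a ≡ᵇ suc M) * F a)
      ≡⟨ ∑ₙ-as-range _ ⟩
        ∑< n (λ i → 𝟙 (i ≡ᵇ M) * F (suc i))
      ≡⟨ ∑<-cong n (λ i _ → atM i) ⟩
        ∑< n (λ i → 𝟙 (i ≡ᵇ M) * F (suc M))
      ≡⟨ ∑<-single n M (F (suc M)) ⟩
        𝟙 (M <ᵇ n) * F (suc M)
      ≡⟨ cong (λ b → 𝟙 b * F (suc M)) (<⇒<ᵇ-true M n M<n) ⟩
        F (suc M) + 0
      ≡⟨ +-identityʳ _ ⟩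
        F (suc M)
      ∎
      where
      open ≡-Reasoning
      atM : ∀ i → 𝟙 (i ≡ᵇ M) * F (suc i) ≡ 𝟙 (i ≡ᵇ M) * F (suc M)
      atM i = 𝟙-guard (i ≡ᵇ M) (λ i≡ᵇM → cong (F ∘ suc) (≡ᵇ-true⇒≡ i M i≡ᵇM))

    ∑ₙ-remove : ∀ M u → InRange M → M ∈ᵇ u ≡ false → ∀ F →
      ∑ₙ (λ a → 𝟙 (not (a ∈ᵇ u)) * F a) ≡ F M + ∑ₙ (λ a → 𝟙 (not (a ∈ᵇ (M ∷ u))) * F a)
    ∑ₙ-remove M u M∈ M∉u F =
      trans (∑-cong (oneTo n) split)
            (trans (∑-+ (oneTo n) _ _) (cong (_+ ∑ₙ (λ a → 𝟙 (not (a ∈ᵇ (M ∷ u))) * F a)) (∑ₙ-single M M∈ F)))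
      where
      split : ∀ a → 𝟙 (not (a ∈ᵇ u)) * F a ≡ 𝟙 (a ≡ᵇ M) * F a + 𝟙 (not (a ∈ᵇ (M ∷ u))) * F a
      split a with a ≡ᵇ M in a≡ᵇM
      ... | true  = trans (cong (λ b → 𝟙 (not b) * F a) (trans (cong (_∈ᵇ u) (≡ᵇ-true⇒≡ a M a≡ᵇM)) M∉u))
                          (sym (+-identityʳ _))
      ... | false = refl

    ∑fresh : List ℕ → ℕ → (List ℕ → ℕ) → ℕ
    ∑fresh u k g = ∑ (words n k) (λ w → 𝟙 (fresh u w) * g w)

    ∑fresh-[] : ∀ u g → ∑fresh u 0 g ≡ g []
    ∑fresh-[] u g = trans (+-identityʳ _) (*-identityˡ (g []))

    ∑fresh-∷ : ∀ u k g → ∑fresh u (suc k) g ≡ ∑ₙ (λ a → 𝟙 (not (a ∈ᵇ u)) * ∑fresh (a ∷ u) k (λ w → g (a ∷ w)))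
    ∑fresh-∷ u k g =
      trans (∑-concatMap (λ a → map (a ∷_) (words n k)) (oneTo n) _)
            (∑-cong (oneTo n) (λ a → trans (∑-map (a ∷_) (words n k) _)
              (trans (∑-cong (words n k) (λ w → factor a w)) (∑-* (𝟙 (not (a ∈ᵇ u))) (words n k) _))))
      where
      factor : ∀ a w → 𝟙 (fresh u (a ∷ w)) * g (a ∷ w) ≡ 𝟙 (not (a ∈ᵇ u)) * (𝟙 (fresh (a ∷ u) w) * g (a ∷ w))
      factor a w = trans (cong (_* g (a ∷ w)) (𝟙-∧ (not (a ∈ᵇ u)) (fresh (a ∷ u) w))) (*-assoc (𝟙 (not (a ∈ᵇ u))) _ _)

    ∑fresh-≋ : ∀ {u v} → u ≋ v → ∀ k g → ∑fresh u k g ≡ ∑fresh v k g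
    ∑fresh-≋ u≋v k g = ∑-cong (words n k) (λ w → cong (λ b → 𝟙 b * g w) (fresh-≋ u≋v w))

    ∑fresh-cong : ∀ u k {g h} → (∀ w → g w ≡ h w) → ∑fresh u k g ≡ ∑fresh u k h
    ∑fresh-cong u k g≡h = ∑-cong (words n k) (λ w → cong (𝟙 (fresh u w) *_) (g≡h w))

    ∑fresh-cong-on : ∀ u k {g h} → (∀ w → fresh u w ≡ true → length w ≡ k → All InRange w → g w ≡ h w) →
      ∑fresh u k g ≡ ∑fresh u k h
    ∑fresh-cong-on u zero    {g} {h} g≡h = trans (∑fresh-[] u g) (trans (g≡h [] refl refl []) (sym (∑fresh-[] u h)))
    ∑fresh-cong-on u (suc k) {g} {h} g≡h =
      trans (∑fresh-∷ u k g) (trans (∑ₙ-cong firstLetter) (sym (∑fresh-∷ u k h)))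
      where
      firstLetter : ∀ a → InRange a →
        𝟙 (not (a ∈ᵇ u)) * ∑fresh (a ∷ u) k (λ w → g (a ∷ w)) ≡ 𝟙 (not (a ∈ᵇ u)) * ∑fresh (a ∷ u) k (λ w → h (a ∷ w))
      firstLetter a a∈ with a ∈ᵇ u in a∈ᵇu
      ... | true  = refl
      ... | false = cong (1 *_) (∑fresh-cong-on (a ∷ u) k (λ w ok len rng →
                      g≡h (a ∷ w) (subst (λ b → not b ∧ fresh (a ∷ u) w ≡ true) (sym a∈ᵇu) ok) (cong suc len) (a∈ ∷ rng)))

    ∑fresh-scale : ∀ u k c g → ∑fresh u k (λ w → c * g w) ≡ c * ∑fresh u k g
    ∑fresh-scale u k c g = trans (∑-cong (words n k) (λ w → *-left-swap (𝟙 (fresh u w)) c (g w))) (∑-* c (words n k) _)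

    ∑fresh-scaleʳ : ∀ u k (g : List ℕ → ℕ) c → ∑fresh u k (λ w → g w * c) ≡ ∑fresh u k g * c
    ∑fresh-scaleʳ u k g c = trans (∑fresh-cong u k (λ w → *-comm (g w) c)) (trans (∑fresh-scale u k c g) (*-comm c _))

    ∑fresh-zero : ∀ u k → ∑fresh u k (λ _ → 0) ≡ 0
    ∑fresh-zero u k = trans (∑-cong (words n k) (λ w → *-zeroʳ (𝟙 (fresh u w)))) (∑-zero (words n k))

    #free : List ℕ → ℕ
    #free u = ∑ₙ (λ a → 𝟙 (not (a ∈ᵇ u)))

    #free-≋ : ∀ {u v} → u ≋ v → #free u ≡ #free v
    #free-≋ u≋v = ∑-cong (oneTo n) (λ a → cong (λ b → 𝟙 (not b)) (members u≋v a))

    #free-∷ : ∀ M u → InRange M → M ∈ᵇ u ≡ false → #free u ≡ suc (#free (M ∷ u))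
    #free-∷ M u M∈ M∉u =
      trans (∑-cong (oneTo n) (λ a → sym (*-identityʳ _)))
            (trans (∑ₙ-remove M u M∈ M∉u (λ _ → 1)) (cong suc (∑-cong (oneTo n) (λ a → *-identityʳ _))))

    #free-++ : ∀ L u → fresh u L ≡ true → All InRange L → #free (L ++ u) + length L ≡ #free u
    #free-++ []      u _  _            = +-identityʳ (#free u)
    #free-++ (a ∷ L) u ok (a∈ ∷ L∈) = begin
        #free (a ∷ (L ++ u)) + suc (length L)
      ≡⟨ +-suc (#free (a ∷ (L ++ u))) (length L) ⟩
        suc (#free (a ∷ (L ++ u)) + length L)
      ≡⟨ cong (λ x → suc (x + length L)) (#free-≋ (≋-move a L u)) ⟩
        suc (#free (L ++ a ∷ u) + length L)
      ≡⟨ cong suc (#free-++ L (a ∷ u) (fresh-tail u a L ok) L∈) ⟩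
        suc (#free (a ∷ u))
      ≡⟨ sym (#free-∷ a u a∈ (fresh-head u a L ok)) ⟩
        #free u
      ∎
      where open ≡-Reasoning

    -- maxFree u k: the largest letter in {1,…,k} not occurring in u, or 0 if there is none.
    maxFree : List ℕ → ℕ → ℕ
    maxFree u zero    = 0
    maxFree u (suc k) = if suc k ∈ᵇ u then maxFree u k else suc k

    maxFree-≤ : ∀ u k → maxFree u k ≤ k
    maxFree-≤ u zero    = z≤n
    maxFree-≤ u (suc k) with suc k ∈ᵇ u
    ... | true  = m≤n⇒m≤1+n (maxFree-≤ u k)
    ... | false = ≤-refl

    maxFree-free : ∀ u k M → maxFree u k ≡ suc M → suc M ∈ᵇ u ≡ false
    maxFree-free u (suc k) M eq with suc k ∈ᵇ u in k+1∈ᵇu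
    ... | true  = maxFree-free u k M eq
    ... | false = subst (λ x → x ∈ᵇ u ≡ false) eq k+1∈ᵇu

    maxFree-max : ∀ u k x → 1 ≤ x → x ≤ k → x ∈ᵇ u ≡ false → x ≤ maxFree u k
    maxFree-max u zero    x 1≤x x≤0 _ = contradiction (≤-trans 1≤x x≤0) λ ()
    maxFree-max u (suc k) x 1≤x x≤k x∉u with suc k ∈ᵇ u in k+1∈ᵇu
    ... | false = x≤k
    ... | true with m≤n⇒m<n∨m≡n x≤k
    ...   | inj₁ x<k+1 = maxFree-max u k x 1≤x (≤-pred x<k+1) x∉u
    ...   | inj₂ refl  = contradiction (trans (sym x∉u) k+1∈ᵇu) λ ()

    ∑fresh-letter-first : ∀ a M u i j (g : List ℕ → ℕ) →
      ∑fresh (M ∷ a ∷ u) i (λ L → ∑fresh (L ++ M ∷ a ∷ u) j (λ R → g (a ∷ L ++ M ∷ R)))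
        ≡ ∑fresh (a ∷ M ∷ u) i (λ L → ∑fresh (a ∷ L ++ M ∷ u) j (λ R → g (a ∷ L ++ M ∷ R)))
    ∑fresh-letter-first a M u i j g =
      trans (∑fresh-≋ (≋-swap M a u) i (λ L → ∑fresh (L ++ M ∷ a ∷ u) j (λ R → g (a ∷ L ++ M ∷ R))))
            (∑fresh-cong (a ∷ M ∷ u) i (λ L →
              ∑fresh-≋ (≋-trans (≋-++ L (≋-swap M a u)) (≋-sym (≋-move a L (M ∷ u)))) j (λ R → g (a ∷ L ++ M ∷ R))))

    ∑fresh-split : ∀ k u g M → InRange M → M ∈ᵇ u ≡ false →
      ∑fresh u k g ≡ ∑fresh (M ∷ u) k g
                     + ∑< k (λ i → ∑fresh (M ∷ u) i (λ L → ∑fresh (L ++ M ∷ u) (k ∸ suc i) (λ R → g (L ++ M ∷ R))))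
    ∑fresh-split zero    u g M _  _    = trans (∑fresh-[] u g) (sym (trans (+-identityʳ _) (∑fresh-[] (M ∷ u) g)))
    ∑fresh-split (suc k) u g M M∈ M∉u = begin
        ∑fresh u (suc k) g
      ≡⟨ ∑fresh-∷ u k g ⟩
        ∑ₙ (λ a → 𝟙 (not (a ∈ᵇ u)) * ∑fresh (a ∷ u) k (λ w → g (a ∷ w)))
      ≡⟨ ∑ₙ-remove M u M∈ M∉u (λ a → ∑fresh (a ∷ u) k (λ w → g (a ∷ w))) ⟩
        ∑fresh (M ∷ u) k (λ w → g (M ∷ w)) + ∑ₙ (λ a → 𝟙 (free a) * ∑fresh (a ∷ u) k (λ w → g (a ∷ w)))
      ≡⟨ cong (∑fresh (M ∷ u) k (λ w → g (M ∷ w)) +_) otherFirstLetter ⟩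
        ∑fresh (M ∷ u) k (λ w → g (M ∷ w)) + (∑fresh (M ∷ u) (suc k) g + ∑< k (λ i → MAt (suc i)))
      ≡⟨ +-left-swap (∑fresh (M ∷ u) k (λ w → g (M ∷ w))) (∑fresh (M ∷ u) (suc k) g) (∑< k (λ i → MAt (suc i))) ⟩
        ∑fresh (M ∷ u) (suc k) g + (∑fresh (M ∷ u) k (λ w → g (M ∷ w)) + ∑< k (λ i → MAt (suc i)))
      ≡⟨ cong (λ x → ∑fresh (M ∷ u) (suc k) g + (x + ∑< k (λ i → MAt (suc i)))) (sym (∑fresh-[] (M ∷ u) (λ L → ∑fresh (L ++ M ∷ u) k (λ R → g (L ++ M ∷ R))))) ⟩
        ∑fresh (M ∷ u) (suc k) g + ∑< (suc k) MAt
      ∎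
      where
      open ≡-Reasoning
      free : ℕ → Bool
      free a = not (a ∈ᵇ (M ∷ u))
      MAt : ℕ → ℕ
      MAt i = ∑fresh (M ∷ u) i (λ L → ∑fresh (L ++ M ∷ u) (k ∸ i) (λ R → g (L ++ M ∷ R)))
      MAfter : ℕ → ℕ → ℕ
      MAfter a i = ∑fresh (a ∷ M ∷ u) i (λ L → ∑fresh (a ∷ L ++ M ∷ u) (k ∸ suc i) (λ R → g (a ∷ L ++ M ∷ R)))
      perLetter : ∀ a → 𝟙 (free a) * ∑fresh (a ∷ u) k (λ w → g (a ∷ w))
                        ≡ 𝟙 (free a) * ∑fresh (a ∷ M ∷ u) k (λ w → g (a ∷ w)) + ∑< k (λ i → 𝟙 (free a) * MAfter a i)
      perLetter a = begin
          𝟙 (free a) * ∑fresh (a ∷ u) k (λ w → g (a ∷ w))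
        ≡⟨ 𝟙-guard (free a) (λ a-free → ∑fresh-split k (a ∷ u) (λ w → g (a ∷ w)) M M∈ (∉-∷ a M u a-free M∉u)) ⟩
          𝟙 (free a) * (∑fresh (M ∷ a ∷ u) k (λ w → g (a ∷ w))
                         + ∑< k (λ i → ∑fresh (M ∷ a ∷ u) i (λ L → ∑fresh (L ++ M ∷ a ∷ u) (k ∸ suc i) (λ R → g (a ∷ L ++ M ∷ R)))))
        ≡⟨ cong₂ (λ x y → 𝟙 (free a) * (x + y)) (∑fresh-≋ (≋-swap M a u) k (λ w → g (a ∷ w)))
                 (∑<-cong k (λ i _ → ∑fresh-letter-first a M u i (k ∸ suc i) g)) ⟩
          𝟙 (free a) * (∑fresh (a ∷ M ∷ u) k (λ w → g (a ∷ w)) + ∑< k (MAfter a))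
        ≡⟨ *-distribˡ-+ (𝟙 (free a)) _ _ ⟩
          𝟙 (free a) * ∑fresh (a ∷ M ∷ u) k (λ w → g (a ∷ w)) + 𝟙 (free a) * ∑< k (MAfter a)
        ≡⟨ cong (𝟙 (free a) * ∑fresh (a ∷ M ∷ u) k (λ w → g (a ∷ w)) +_) (sym (∑<-* k (𝟙 (free a)) (MAfter a))) ⟩
          𝟙 (free a) * ∑fresh (a ∷ M ∷ u) k (λ w → g (a ∷ w)) + ∑< k (λ i → 𝟙 (free a) * MAfter a i)
        ∎
      otherFirstLetter : ∑ₙ (λ a → 𝟙 (free a) * ∑fresh (a ∷ u) k (λ w → g (a ∷ w)))
                         ≡ ∑fresh (M ∷ u) (suc k) g + ∑< k (λ i → MAt (suc i))
      otherFirstLetter = begin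
          ∑ₙ (λ a → 𝟙 (free a) * ∑fresh (a ∷ u) k (λ w → g (a ∷ w)))
        ≡⟨ ∑-cong (oneTo n) perLetter ⟩
          ∑ₙ (λ a → 𝟙 (free a) * ∑fresh (a ∷ M ∷ u) k (λ w → g (a ∷ w)) + ∑< k (λ i → 𝟙 (free a) * MAfter a i))
        ≡⟨ ∑-+ (oneTo n) _ _ ⟩
          ∑ₙ (λ a → 𝟙 (free a) * ∑fresh (a ∷ M ∷ u) k (λ w → g (a ∷ w))) + ∑ₙ (λ a → ∑< k (λ i → 𝟙 (free a) * MAfter a i))
        ≡⟨ cong₂ _+_ (sym (∑fresh-∷ (M ∷ u) k g)) (∑-∑< (oneTo n) k (λ a i → 𝟙 (free a) * MAfter a i)) ⟩
          ∑fresh (M ∷ u) (suc k) g + ∑< k (λ i → ∑ₙ (λ a → 𝟙 (free a) * MAfter a i))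
        ≡⟨ cong (∑fresh (M ∷ u) (suc k) g +_) (∑<-cong k (λ i _ → sym (∑fresh-∷ (M ∷ u) i _))) ⟩
          ∑fresh (M ∷ u) (suc k) g + ∑< k (λ i → MAt (suc i))
        ∎

    ∑ₙ-no-free : ∀ u → maxFree u n ≡ 0 → (F : ℕ → ℕ) → ∑ₙ (λ a → 𝟙 (not (a ∈ᵇ u)) * F a) ≡ 0
    ∑ₙ-no-free u none F = trans (∑ₙ-cong used) (∑-zero (oneTo n))
      where
      used : ∀ a → InRange a → 𝟙 (not (a ∈ᵇ u)) * F a ≡ 0
      used a (1≤a , a≤n) with a ∈ᵇ u in a∈ᵇu
      ... | true  = refl
      ... | false = contradiction (≤-trans 1≤a (subst (a ≤_) none (maxFree-max u n a 1≤a a≤n a∈ᵇu))) λ ()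

    #freshPeak : List ℕ → ℕ → ℕ → List ℕ → ℕ
    #freshPeak u j s S = ∑fresh u j (λ w → 𝟙 (eqList (peaksFrom s w) S))

    ∑fresh-withApex : ∀ v j b t D s → ∑fresh v j (λ R → 𝟙 (eqList (apexList b t ++ peaksFrom s R) D))
                                      ≡ withApex b t D (#freshPeak v j s)
    ∑fresh-withApex v j false t D       s = refl
    ∑fresh-withApex v j true  t []      s = ∑fresh-zero v j
    ∑fresh-withApex v j true  t (x ∷ D) s =
      trans (∑fresh-cong v j (λ R → 𝟙-∧ (t ≡ᵇ x) (eqList (peaksFrom s R) D))) (∑fresh-scale v j (𝟙 (t ≡ᵇ x)) _)

    below-max : ∀ M u L → (∀ x → InRange x → x ∈ᵇ u ≡ false → x ≤ M) →
      All (λ x → x ∈ᵇ (M ∷ u) ≡ false) L → All InRange L → All (_< M) L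
    below-max M u []      M-max _          _          = []
    below-max M u (x ∷ L) M-max (x∉ ∷ L∉) (x∈ ∷ L∈) = x<M ∷ below-max M u L M-max L∉ L∈
      where
      x<M : x < M
      x<M = ≤∧≢⇒< (M-max x x∈ (∨-conicalʳ _ _ x∉))
                  (λ x≡M → contradiction (trans (sym (≡ᵇ-refl x)) (trans (cong (x ≡ᵇ_) x≡M) (∨-conicalˡ _ _ x∉))) λ ())

    avoids-suffix : ∀ L u R → All (λ x → x ∈ᵇ (L ++ u) ≡ false) R → All (λ x → x ∈ᵇ u ≡ false) R
    avoids-suffix L u []      _          = []
    avoids-suffix L u (x ∷ R) (x∉ ∷ R∉) =
      ∨-conicalʳ _ _ (trans (sym (∈ᵇ-++ x L u)) x∉) ∷ avoids-suffix L u R R∉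

    -- Standardisation up to a bound on the number of free letters: a fresh word only "sees" the
    -- relative order of its letters, so the count is binom (#free u) j times the count for permutations.
    Standardisation : ℕ → Set
    Standardisation B = ∀ u → #free u ≤ B → ∀ j f s S → j ≤ f →
      #freshPeak u j s S ≡ binom (#free u) j * peakCount f j s S

    -- One step of standardisation: split the words at the largest free letter M of u, and use the
    -- claim for M ∷ u and for the lists L ++ M ∷ u, which have fewer free letters.
    module AtMaximum {B} (IH : Standardisation B) (u : List ℕ) (M : ℕ) (M∈ : InRange M) (M∉u : M ∈ᵇ u ≡ false)
                     (M-max : ∀ x → InRange x → x ∈ᵇ u ≡ false → x ≤ M) (few : #free (M ∷ u) ≤ B)
                     (k f s : ℕ) (S : List ℕ) (k≤f : k ≤ f) where

      N : ℕ
      N = #free (M ∷ u)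

      peakTest : List ℕ → ℕ
      peakTest w = 𝟙 (eqList (peaksFrom s w) S)

      leftTest : ℕ → List ℕ → ℕ
      leftTest i L = 𝟙 (eqList (peaksFrom s L) (below (i + s) S))

      apexTest : ℕ → List ℕ → ℕ
      apexTest i R = 𝟙 (eqList (apexList (isApex i k) (i + s) ++ peaksFrom (suc (i + s)) R) (fromPos (i + s) S))

      right : ℕ → ℕ
      right i = withApex (isApex i k) (i + s) (fromPos (i + s) S) (peakCount f (k ∸ i) (suc (i + s)))

      term : ℕ → ℕ
      term = maxTerm f k s S

      rightParts : ∀ i → ∀ L → fresh (M ∷ u) L ≡ true → length L ≡ i → All InRange L →
        ∑fresh (L ++ M ∷ u) (k ∸ i) (λ R → peakTest (L ++ M ∷ R)) ≡ leftTest i L * (binom (N ∸ i) (k ∸ i) * right i)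
      rightParts i L okL lenL L∈ = begin
          ∑fresh v (k ∸ i) (λ R → peakTest (L ++ M ∷ R))
        ≡⟨ ∑fresh-cong-on v (k ∸ i) (λ R okR lenR R∈ →
             peakSet-at-max s S L M R i k L<M (below-max M u R M-max (avoids-suffix L (M ∷ u) R (fresh-avoids v R okR)) R∈) lenL lenR) ⟩
          ∑fresh v (k ∸ i) (λ R → leftTest i L * apexTest i R)
        ≡⟨ ∑fresh-scale v (k ∸ i) (leftTest i L) (apexTest i) ⟩
          leftTest i L * ∑fresh v (k ∸ i) (apexTest i)
        ≡⟨ cong (leftTest i L *_) (∑fresh-withApex v (k ∸ i) (isApex i k) (i + s) (fromPos (i + s) S) (suc (i + s))) ⟩
          leftTest i L * withApex (isApex i k) (i + s) (fromPos (i + s) S) (#freshPeak v (k ∸ i) (suc (i + s)))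
        ≡⟨ cong (leftTest i L *_) (withApex-cong (isApex i k) (i + s) (fromPos (i + s) S)
                                    (λ D → IH v v-few (k ∸ i) f (suc (i + s)) D (≤-trans (m∸n≤m k i) k≤f))) ⟩
          leftTest i L * withApex (isApex i k) (i + s) (fromPos (i + s) S) (λ D → binom (#free v) (k ∸ i) * peakCount f (k ∸ i) (suc (i + s)) D)
        ≡⟨ cong (leftTest i L *_) (withApex-scale (isApex i k) (i + s) (fromPos (i + s) S) (binom (#free v) (k ∸ i)) _) ⟩
          leftTest i L * (binom (#free v) (k ∸ i) * right i)
        ≡⟨ cong (λ x → leftTest i L * (binom x (k ∸ i) * right i)) #free-v ⟩
          leftTest i L * (binom (N ∸ i) (k ∸ i) * right i)
        ∎
        where
        open ≡-Reasoning
        v : List ℕ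
        v = L ++ M ∷ u
        L<M : All (_< M) L
        L<M = below-max M u L M-max (fresh-avoids (M ∷ u) L okL) L∈
        #free-v+i : #free v + i ≡ N
        #free-v+i = trans (cong (#free v +_) (sym lenL)) (#free-++ L (M ∷ u) okL L∈)
        #free-v : #free v ≡ N ∸ i
        #free-v = trans (sym (m+n∸n≡m (#free v) i)) (cong (_∸ i) #free-v+i)
        v-few : #free v ≤ B
        v-few = ≤-trans (subst (#free v ≤_) #free-v+i (m≤m+n (#free v) i)) few

      maxAt : ∀ i → i < suc k →
        ∑fresh (M ∷ u) i (λ L → ∑fresh (L ++ M ∷ u) (k ∸ i) (λ R → peakTest (L ++ M ∷ R))) ≡ binom N k * term i
      maxAt i (s≤s i≤k) = begin
          ∑fresh (M ∷ u) i (λ L → ∑fresh (L ++ M ∷ u) (k ∸ i) (λ R → peakTest (L ++ M ∷ R)))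
        ≡⟨ ∑fresh-cong-on (M ∷ u) i (rightParts i) ⟩
          ∑fresh (M ∷ u) i (λ L → leftTest i L * (binom (N ∸ i) (k ∸ i) * right i))
        ≡⟨ ∑fresh-scaleʳ (M ∷ u) i (leftTest i) _ ⟩
          #freshPeak (M ∷ u) i s (below (i + s) S) * (binom (N ∸ i) (k ∸ i) * right i)
        ≡⟨ cong (_* (binom (N ∸ i) (k ∸ i) * right i)) (IH (M ∷ u) few i f s (below (i + s) S) (≤-trans i≤k k≤f)) ⟩
          binom N i * peakCount f i s (below (i + s) S) * (binom (N ∸ i) (k ∸ i) * right i)
        ≡⟨ *-interchange (binom N i) _ _ _ ⟩
          binom N i * binom (N ∸ i) (k ∸ i) * (peakCount f i s (below (i + s) S) * right i)
        ≡⟨ cong (_* (peakCount f i s (below (i + s) S) * right i)) (binom-subset N i k i≤k) ⟩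
          binom N k * binom k i * (peakCount f i s (below (i + s) S) * right i)
        ≡⟨ *-assoc (binom N k) (binom k i) _ ⟩
          binom N k * term i
        ∎
        where open ≡-Reasoning

      step : #freshPeak u (suc k) s S ≡ binom (#free u) (suc k) * peakCount (suc f) (suc k) s S
      step = begin
          #freshPeak u (suc k) s S
        ≡⟨ ∑fresh-split (suc k) u peakTest M M∈ M∉u ⟩
          #freshPeak (M ∷ u) (suc k) s S
            + ∑< (suc k) (λ i → ∑fresh (M ∷ u) i (λ L → ∑fresh (L ++ M ∷ u) (k ∸ i) (λ R → peakTest (L ++ M ∷ R))))
        ≡⟨ cong₂ _+_ (IH (M ∷ u) few (suc k) (suc f) s S (s≤s k≤f)) (∑<-cong (suc k) maxAt) ⟩
          binom N (suc k) * count + ∑< (suc k) (λ i → binom N k * term i)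
        ≡⟨ cong (binom N (suc k) * count +_) (∑<-* (suc k) (binom N k) term) ⟩
          binom N (suc k) * count + binom N k * count
        ≡⟨ sym (*-distribʳ-+ count (binom N (suc k)) (binom N k)) ⟩
          (binom N (suc k) + binom N k) * count
        ≡⟨ cong (_* count) (+-comm (binom N (suc k)) (binom N k)) ⟩
          binom (suc N) (suc k) * count
        ≡⟨ cong (λ x → binom x (suc k) * count) (sym (#free-∷ M u M∈ M∉u)) ⟩
          binom (#free u) (suc k) * count
        ∎
        where
        open ≡-Reasoning
        count : ℕ
        count = peakCount (suc f) (suc k) s S

    standardise : ∀ B → Standardisation B
    standardise B u few zero    f       s S _         =
      trans (∑fresh-[] u (λ w → 𝟙 (eqList (peaksFrom s w) S))) (sym (+-identityʳ _))
    standardise B u few (suc k) (suc f) s S (s≤s k≤f) with maxFree u n in max≡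
    ... | zero  = trans (trans (∑fresh-∷ u k _) (∑ₙ-no-free u max≡ _))
                        (sym (cong (λ x → binom x (suc k) * peakCount (suc f) (suc k) s S) noneFree))
      where
      noneFree : #free u ≡ 0
      noneFree = trans (∑-cong (oneTo n) (λ a → sym (*-identityʳ _))) (∑ₙ-no-free u max≡ (λ _ → 1))
    ... | suc M = atMax B few
      where
      M∈ : InRange (suc M)
      M∈ = s≤s z≤n , subst (_≤ n) max≡ (maxFree-≤ u n)
      M∉u : suc M ∈ᵇ u ≡ false
      M∉u = maxFree-free u n M max≡
      M-max : ∀ x → InRange x → x ∈ᵇ u ≡ false → x ≤ suc M
      M-max x (1≤x , x≤n) x∉u = subst (x ≤_) max≡ (maxFree-max u n x 1≤x x≤n x∉u)
      atMax : ∀ B → #free u ≤ B → #freshPeak u (suc k) s S ≡ binom (#free u) (suc k) * peakCount (suc f) (suc k) s S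
      atMax zero    few′ = contradiction (subst (_≤ 0) (#free-∷ (suc M) u M∈ M∉u) few′) λ ()
      atMax (suc B′) few′ = AtMaximum.step (standardise B′) u (suc M) M∈ M∉u M-max
                              (≤-pred (subst (_≤ suc B′) (#free-∷ (suc M) u M∈ M∉u) few′)) k f s S k≤f

  open FreshWords using (#free; #freshPeak; standardise; ∑fresh-cong-on; ∑fresh-zero; ∑ₙ-as-range)

  ∑<-ones : ∀ n → ∑< n (λ _ → 1) ≡ n
  ∑<-ones zero    = refl
  ∑<-ones (suc n) = cong suc (∑<-ones n)

  #free-[] : ∀ n → #free n [] ≡ n
  #free-[] n = trans (∑ₙ-as-range n _) (∑<-ones n)

  peakCount-counts-permutations : ∀ f j s S → j ≤ f → #freshPeak j [] j s S ≡ peakCount f j s S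
  peakCount-counts-permutations f j s S j≤f = begin
      #freshPeak j [] j s S
    ≡⟨ standardise j j [] (≤-reflexive (#free-[] j)) j f s S j≤f ⟩
      binom (#free j []) j * peakCount f j s S
    ≡⟨ cong (λ x → binom x j * peakCount f j s S) (#free-[] j) ⟩
      binom j j * peakCount f j s S
    ≡⟨ cong (_* peakCount f j s S) (binom-diag j) ⟩
      1 * peakCount f j s S
    ≡⟨ *-identityˡ _ ⟩
      peakCount f j s S
    ∎
    where open ≡-Reasoning

  peakCount-impossible : ∀ f j s S → j ≤ f → (∀ w → length w ≡ j → ¬ peaksFrom s w ≡ S) → peakCount f j s S ≡ 0
  peakCount-impossible f j s S j≤f never =
    trans (sym (peakCount-counts-permutations f j s S j≤f))
          (trans (∑fresh-cong-on j [] j (λ w _ len _ → cong 𝟙 (dec-false (≡-dec _≟_ (peaksFrom s w) S) (never w len))))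
                 (∑fresh-zero j [] j))

  peakCount-early : ∀ f j s x R → j ≤ f → x ≤ s → peakCount f j s (x ∷ R) ≡ 0
  peakCount-early f j s x R j≤f x≤s = peakCount-impossible f j s (x ∷ R) j≤f early
    where
    early : ∀ w → length w ≡ j → ¬ peaksFrom s w ≡ x ∷ R
    early w _ eq with peaksFrom s w | peaks-after-start s w
    early w _ refl | .x ∷ _ | s<x ∷ _ = <-irrefl refl (<-≤-trans s<x x≤s)

  peakCount-unfold : ∀ f k s S → peakCount (suc f) (suc (suc k)) s S
    ≡ maxTerm f (suc k) s S 0 + ∑< k (λ i → maxTerm f (suc k) s S (suc i)) + maxTerm f (suc k) s S (suc k)
  peakCount-unfold f k s S = ∑<-last (suc k) (maxTerm f (suc k) s S)

  zeroʳ-by : ∀ a {b} → b ≡ 0 → a * b ≡ 0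
  zeroʳ-by a b≡0 = trans (cong (a *_) b≡0) (*-zeroʳ a)

  noPeakCount : ℕ → ℕ
  noPeakCount zero    = 1
  noPeakCount (suc k) = 2 ^ k

  -- In a permutation without peaks the maximum comes first or last, and the rest has no peaks.
  peakCount-no-peaks : ∀ f j s → j ≤ f → peakCount f j s [] ≡ noPeakCount j
  peakCount-no-peaks f       zero          s _         = refl
  peakCount-no-peaks (suc f) (suc zero)    s _         = refl
  peakCount-no-peaks (suc f) (suc (suc k)) s (s≤s j≤f) = begin
      peakCount (suc f) (suc (suc k)) s []
    ≡⟨ peakCount-unfold f k s [] ⟩
      T 0 + ∑< k (λ i → T (suc i)) + T (suc k)
    ≡⟨ cong₂ (λ x y → x + y + T (suc k)) first (trans (∑<-cong k interior) (∑<-zero k)) ⟩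
      2 ^ k + 0 + T (suc k)
    ≡⟨ cong₂ _+_ (+-identityʳ (2 ^ k)) last ⟩
      2 ^ k + 2 ^ k
    ≡⟨ cong (2 ^ k +_) (sym (+-identityʳ (2 ^ k))) ⟩
      2 ^ suc k
    ∎
    where
    open ≡-Reasoning
    T : ℕ → ℕ
    T = maxTerm f (suc k) s []
    first : T 0 ≡ 2 ^ k
    first = trans (+-identityʳ _) (trans (+-identityʳ _) (peakCount-no-peaks f (suc k) (suc s) j≤f))
    interior : ∀ i → i < k → T (suc i) ≡ 0
    interior i i<k rewrite <⇒<ᵇ-true i k i<k = zeroʳ-by (binom (suc k) (suc i)) (*-zeroʳ (peakCount f (suc i) s []))
    last : T (suc k) ≡ 2 ^ k
    last rewrite ≥⇒<ᵇ-false k k ≤-refl | binom-diag k | binom-> k (suc k) ≤-refl | n∸n≡0 k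
               | *-identityʳ (peakCount f (suc k) s []) = trans (+-identityʳ _) (peakCount-no-peaks f (suc k) s j≤f)

  shift-<ᵇ : ∀ s d k → (s + suc d <ᵇ suc (k + s)) ≡ (d <ᵇ k)
  shift-<ᵇ s d k rewrite +-suc s d | +-comm k s = cancel s
    where
    cancel : ∀ s → (s + d <ᵇ s + k) ≡ (d <ᵇ k)
    cancel zero    = refl
    cancel (suc s) = cancel s

  shift-≡ᵇ : ∀ s d k → (suc (k + s) ≡ᵇ s + suc d) ≡ (k ≡ᵇ d)
  shift-≡ᵇ s d k rewrite +-suc s d | +-comm k s = cancel s
    where
    cancel : ∀ s → (s + k ≡ᵇ s + d) ≡ (k ≡ᵇ d)
    cancel zero    = refl
    cancel (suc s) = cancel s

  -- With a single peak at s + suc d, only the maximum sitting on the peak contributes in the interior.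
  onePeak-interior : ∀ f k s d → ∑< k (λ i → maxTerm f (suc k) s (s + suc d ∷ []) (suc i))
    ≡ 𝟙 (d <ᵇ k) * (binom (suc k) (suc d) * (peakCount f (suc d) s [] * (1 * peakCount f (k ∸ d) (suc (suc (d + s))) [])))
  onePeak-interior f k s d = trans (∑<-cong k atI) (∑<-single k d _)
    where
    atI : ∀ i → i < k → maxTerm f (suc k) s (s + suc d ∷ []) (suc i)
      ≡ 𝟙 (i ≡ᵇ d) * (binom (suc k) (suc d) * (peakCount f (suc d) s [] * (1 * peakCount f (k ∸ d) (suc (suc (d + s))) [])))
    atI i i<k rewrite <⇒<ᵇ-true i k i<k | shift-<ᵇ s d i with d <ᵇ i in d<ᵇi
    ... | true rewrite ≢⇒≡ᵇ-false i d (λ i≡d → <-irrefl (sym i≡d) (<ᵇ-true⇒< d i d<ᵇi)) =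
      zeroʳ-by (binom (suc k) (suc i)) (*-zeroʳ (peakCount f (suc i) s (s + suc d ∷ [])))
    ... | false rewrite shift-≡ᵇ s d i with i ≡ᵇ d in i≡ᵇd
    ...   | true with refl ← ≡ᵇ-true⇒≡ i d i≡ᵇd = sym (+-identityʳ _)
    ...   | false = zeroʳ-by (binom (suc k) (suc i)) (*-zeroʳ (peakCount f (suc i) s []))

  -- With the maximum last, the rest must carry the peak, which must then lie before position k.
  onePeak-last : ∀ f k s d → maxTerm f (suc k) s (s + suc d ∷ []) (suc k) ≡ 𝟙 (d <ᵇ k) * peakCount f (suc k) s (s + suc d ∷ [])
  onePeak-last f k s d rewrite shift-<ᵇ s d k | ≥⇒<ᵇ-false k k ≤-refl | n∸n≡0 k | binom-diag (suc k) with d <ᵇ k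
  ... | true  = cong (1 *_) (*-identityʳ _)
  ... | false = cong (1 *_) (*-zeroʳ (peakCount f (suc k) s []))

  2^-split : ∀ d k → d ≤ k → 2 ^ d * (1 * 2 ^ (k ∸ d)) ≡ 2 ^ k
  2^-split d k d≤k =
    trans (cong (2 ^ d *_) (*-identityˡ _)) (trans (sym (^-distribˡ-+-* 2 d (k ∸ d))) (cong (2 ^_) (m+[n∸m]≡n d≤k)))

  -- The arithmetic of the single-peak recursion, by cases on the peak position d against k:
  -- c₀, c₁ are the counts with the maximum first and last, V the count with the maximum on the peak.
  onePeak-combine : ∀ k d c₀ c₁ V → Tri (d < k) (d ≡ k) (k < d) →
    c₀ + 2 ^ (k ∸ 1) * 𝟙 (d <ᵇ suc k) ≡ 2 ^ (k ∸ 1) * binom k d →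
    c₁ + 2 ^ (k ∸ 1) * 𝟙 (d <ᵇ k) ≡ 2 ^ (k ∸ 1) * binom k (suc d) →
    (d < k → V ≡ binom (suc k) (suc d) * (2 ^ d * (1 * noPeakCount (k ∸ d)))) →
    (c₀ + 𝟙 (d <ᵇ k) * V) + 𝟙 (d <ᵇ k) * c₁ + 2 ^ k * 𝟙 (d <ᵇ suc k) ≡ 2 ^ k * binom (suc k) (suc d)
  onePeak-combine zero    d c₀ c₁ V (tri< () _ _) _ _ _
  onePeak-combine (suc k) d c₀ c₁ V (tri< d<k _ _) first last onPeak
    rewrite <⇒<ᵇ-true d (suc k) d<k | <⇒<ᵇ-true d (suc (suc k)) (m<n⇒m<1+n d<k) = begin
      (c₀ + 1 * V) + 1 * c₁ + 2 * X * 1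
    ≡⟨ regroup c₀ c₁ X V ⟩
      (c₀ + X * 1) + (c₁ + X * 1) + V
    ≡⟨ cong₂ (λ x y → x + y + V) first last ⟩
      X * binom (suc k) d + X * binom (suc k) (suc d) + V
    ≡⟨ cong (X * binom (suc k) d + X * binom (suc k) (suc d) +_) V≡ ⟩
      X * binom (suc k) d + X * binom (suc k) (suc d) + (binom (suc k) d + binom (suc k) (suc d)) * X
    ≡⟨ collect X (binom (suc k) d) (binom (suc k) (suc d)) ⟩
      2 * X * (binom (suc k) d + binom (suc k) (suc d))
    ∎
    where
    open ≡-Reasoning
    X : ℕ
    X = 2 ^ k
    V≡ : V ≡ (binom (suc k) d + binom (suc k) (suc d)) * X
    V≡ = trans (onPeak d<k) (cong (binom (suc (suc k)) (suc d) *_)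
           (trans (cong (λ x → 2 ^ d * (1 * noPeakCount x)) (+-∸-assoc 1 (≤-pred d<k))) (2^-split d k (≤-pred d<k))))
    regroup : ∀ c₀ c₁ X V → (c₀ + 1 * V) + 1 * c₁ + 2 * X * 1 ≡ (c₀ + X * 1) + (c₁ + X * 1) + V
    regroup = solve-∀
    collect : ∀ X B₁ B₂ → X * B₁ + X * B₂ + (B₁ + B₂) * X ≡ 2 * X * (B₁ + B₂)
    collect = solve-∀
  onePeak-combine k .k c₀ c₁ V (tri≈ _ refl _) first _ _
    rewrite ≥⇒<ᵇ-false k k ≤-refl | <⇒<ᵇ-true k (suc k) ≤-refl | binom-diag k | binom-> k (suc k) ≤-refl
          | +-cancelʳ-≡ (2 ^ (k ∸ 1) * 1) c₀ 0 first = refl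
  onePeak-combine k d c₀ c₁ V (tri> _ _ k<d) first _ _
    rewrite ≥⇒<ᵇ-false d k (<⇒≤ k<d) | ≥⇒<ᵇ-false d (suc k) k<d | binom-> k d k<d | binom-> k (suc d) (m<n⇒m<1+n k<d)
          | *-zeroʳ (2 ^ (k ∸ 1)) | +-identityʳ c₀ | first = refl

  -- Permutations of {1,…,j} with a single peak at position s + d (the first letter being at s):
  -- their number is 2^(j-2) (C(j-1, d) - 1) for 0 ≤ d ≤ j - 1, stated without subtraction.
  peakCount-one-peak : ∀ f j s d → j ≤ f →
    peakCount f j s (s + d ∷ []) + 2 ^ (j ∸ 2) * 𝟙 (d <ᵇ suc (j ∸ 1)) ≡ 2 ^ (j ∸ 2) * binom (j ∸ 1) d
  peakCount-one-peak f       zero    s (suc d) _ = refl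
  peakCount-one-peak f       j       s zero    j≤f
    rewrite peakCount-early f j s (s + 0) [] j≤f (≤-reflexive (+-identityʳ s)) = refl
  peakCount-one-peak (suc f) (suc zero) s (suc d) _ rewrite ≥⇒<ᵇ-false (s + suc d) s (m≤m+n s (suc d)) = refl
  peakCount-one-peak (suc f) (suc (suc k)) s (suc d) (s≤s j≤f) = begin
      peakCount (suc f) (suc (suc k)) s S + 2 ^ k * 𝟙 (d <ᵇ suc k)
    ≡⟨ cong (_+ 2 ^ k * 𝟙 (d <ᵇ suc k)) (peakCount-unfold f k s S) ⟩
      maxTerm f (suc k) s S 0 + ∑< k (λ i → maxTerm f (suc k) s S (suc i)) + maxTerm f (suc k) s S (suc k) + 2 ^ k * 𝟙 (d <ᵇ suc k)
    ≡⟨ cong (λ x → x + 2 ^ k * 𝟙 (d <ᵇ suc k))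
            (cong₂ _+_ (cong₂ _+_ maxFirst (onePeak-interior f k s d)) (onePeak-last f k s d)) ⟩
      (c₀ + 𝟙 (d <ᵇ k) * V) + 𝟙 (d <ᵇ k) * c₁ + 2 ^ k * 𝟙 (d <ᵇ suc k)
    ≡⟨ onePeak-combine k d c₀ c₁ V (<-cmp d k) IH₀ IH₁ onPeak ⟩
      2 ^ k * binom (suc k) (suc d)
    ∎
    where
    open ≡-Reasoning
    S : List ℕ
    S = s + suc d ∷ []
    c₀ c₁ V : ℕ
    c₀ = peakCount f (suc k) (suc s) S
    c₁ = peakCount f (suc k) s S
    V  = binom (suc k) (suc d) * (peakCount f (suc d) s [] * (1 * peakCount f (k ∸ d) (suc (suc (d + s))) []))
    maxFirst : maxTerm f (suc k) s S 0 ≡ c₀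
    maxFirst rewrite ≥⇒<ᵇ-false (s + suc d) s (m≤m+n s (suc d)) = trans (*-identityˡ _) (*-identityˡ _)
    IH₀ : c₀ + 2 ^ (k ∸ 1) * 𝟙 (d <ᵇ suc k) ≡ 2 ^ (k ∸ 1) * binom k d
    IH₀ = subst (λ x → peakCount f (suc k) (suc s) (x ∷ []) + 2 ^ (k ∸ 1) * 𝟙 (d <ᵇ suc k) ≡ 2 ^ (k ∸ 1) * binom k d)
                (sym (+-suc s d)) (peakCount-one-peak f (suc k) (suc s) d j≤f)
    IH₁ : c₁ + 2 ^ (k ∸ 1) * 𝟙 (d <ᵇ k) ≡ 2 ^ (k ∸ 1) * binom k (suc d)
    IH₁ = peakCount-one-peak f (suc k) s (suc d) j≤f
    onPeak : d < k → V ≡ binom (suc k) (suc d) * (2 ^ d * (1 * noPeakCount (k ∸ d)))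
    onPeak d<k = cong (binom (suc k) (suc d) *_)
      (cong₂ (λ x y → x * (1 * y)) (peakCount-no-peaks f (suc d) s (≤-trans d<k (≤-trans (n≤1+n k) j≤f)))
                                   (peakCount-no-peaks f (k ∸ d) (suc (suc (d + s))) (≤-trans (m∸n≤m k d) (≤-trans (n≤1+n k) j≤f))))

  twoPeaks-arith : ∀ a e X a₀ b₀ c₀ cq Z ck →
    cq + X * 1 ≡ X * a₀ → Z + X ≡ X * (2 + a) → ck + (2 + e + a) * X ≡ ((1 + a) * c₀ + (2 + a) * b₀) * X →
    (2 + a) * b₀ + (1 + a) * a₀ ≡ (2 + e + a) * a₀ →
    (4 + e + a) * cq + (a₀ + b₀ + (b₀ + c₀)) * Z + ck + (3 + e + a) * (2 * X)
      ≡ ((1 + a) * (b₀ + c₀) + (2 + a) * (a₀ + b₀)) * (2 * X)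
  twoPeaks-arith a e X a₀ b₀ c₀ cq Z ck h₁ h₂ h₃ h₄ = +-cancelʳ-≡ _ _ _ (begin
      lhs + extra
    ≡⟨ expand a e X a₀ b₀ c₀ cq Z ck ⟩
      (4 + e + a) * (cq + X * 1) + (a₀ + b₀ + (b₀ + c₀)) * (Z + X) + (ck + (2 + e + a) * X)
        + (3 + e + a) * (2 * X) + X * ((2 + a) * b₀ + (1 + a) * a₀)
    ≡⟨ cong₂ (λ p q → (4 + e + a) * p + (a₀ + b₀ + (b₀ + c₀)) * q + (ck + (2 + e + a) * X)
                         + (3 + e + a) * (2 * X) + X * ((2 + a) * b₀ + (1 + a) * a₀)) h₁ h₂ ⟩
      (4 + e + a) * (X * a₀) + (a₀ + b₀ + (b₀ + c₀)) * (X * (2 + a)) + (ck + (2 + e + a) * X)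
        + (3 + e + a) * (2 * X) + X * ((2 + a) * b₀ + (1 + a) * a₀)
    ≡⟨ cong (λ p → (4 + e + a) * (X * a₀) + (a₀ + b₀ + (b₀ + c₀)) * (X * (2 + a)) + p
                     + (3 + e + a) * (2 * X) + X * ((2 + a) * b₀ + (1 + a) * a₀)) h₃ ⟩
      (4 + e + a) * (X * a₀) + (a₀ + b₀ + (b₀ + c₀)) * (X * (2 + a)) + ((1 + a) * c₀ + (2 + a) * b₀) * X
        + (3 + e + a) * (2 * X) + X * ((2 + a) * b₀ + (1 + a) * a₀)
    ≡⟨ collect a e X a₀ b₀ c₀ ⟩
      ((1 + a) * (b₀ + c₀) + (2 + a) * (a₀ + b₀)) * (2 * X)
        + ((4 + e + a) * X + (a₀ + b₀ + (b₀ + c₀)) * X + (2 + e + a) * X + X * ((2 + e + a) * a₀))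
    ≡⟨ cong (λ q → ((1 + a) * (b₀ + c₀) + (2 + a) * (a₀ + b₀)) * (2 * X)
                     + ((4 + e + a) * X + (a₀ + b₀ + (b₀ + c₀)) * X + (2 + e + a) * X + X * q)) (sym h₄) ⟩
      ((1 + a) * (b₀ + c₀) + (2 + a) * (a₀ + b₀)) * (2 * X) + extra
    ∎)
    where
    open ≡-Reasoning
    lhs extra : ℕ
    lhs   = (4 + e + a) * cq + (a₀ + b₀ + (b₀ + c₀)) * Z + ck + (3 + e + a) * (2 * X)
    extra = (4 + e + a) * X + (a₀ + b₀ + (b₀ + c₀)) * X + (2 + e + a) * X + X * ((2 + a) * b₀ + (1 + a) * a₀)
    expand : ∀ a e X a₀ b₀ c₀ cq Z ck →
      ((4 + e + a) * cq + (a₀ + b₀ + (b₀ + c₀)) * Z + ck + (3 + e + a) * (2 * X))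
        + ((4 + e + a) * X + (a₀ + b₀ + (b₀ + c₀)) * X + (2 + e + a) * X + X * ((2 + a) * b₀ + (1 + a) * a₀))
      ≡ (4 + e + a) * (cq + X * 1) + (a₀ + b₀ + (b₀ + c₀)) * (Z + X) + (ck + (2 + e + a) * X)
        + (3 + e + a) * (2 * X) + X * ((2 + a) * b₀ + (1 + a) * a₀)
    expand = solve-∀
    collect : ∀ a e X a₀ b₀ c₀ →
      (4 + e + a) * (X * a₀) + (a₀ + b₀ + (b₀ + c₀)) * (X * (2 + a)) + ((1 + a) * c₀ + (2 + a) * b₀) * X
        + (3 + e + a) * (2 * X) + X * ((2 + a) * b₀ + (1 + a) * a₀)
      ≡ ((1 + a) * (b₀ + c₀) + (2 + a) * (a₀ + b₀)) * (2 * X)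
        + ((4 + e + a) * X + (a₀ + b₀ + (b₀ + c₀)) * X + (2 + e + a) * X + X * ((2 + e + a) * a₀))
    collect = solve-∀

  -- Permutations with peak set {2, m}, m = 4 + a, positions counted from 1.
  module TwoPeaks (a : ℕ) where

    S : List ℕ
    S = 2 ∷ 4 + a ∷ []

    below-S : ∀ t → 4 + a < t → below t S ≡ S
    below-S t m<t rewrite <⇒<ᵇ-true 2 t (≤-trans (s≤s (s≤s (s≤s z≤n))) m<t) | <⇒<ᵇ-true (4 + a) t m<t = refl

    fromPos-S : ∀ t → 4 + a < t → fromPos t S ≡ []
    fromPos-S t m<t rewrite <⇒<ᵇ-true 2 t (≤-trans (s≤s (s≤s (s≤s z≤n))) m<t) | <⇒<ᵇ-true (4 + a) t m<t = refl

    -- A permutation of {1,…,m} cannot have a peak at its last position m.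
    too-short : ∀ f → 4 + a ≤ f → peakCount f (4 + a) 1 S ≡ 0
    too-short f m≤f = peakCount-impossible f (4 + a) 1 S m≤f lastNoPeak
      where
      lastNoPeak : ∀ w → length w ≡ 4 + a → ¬ peaksFrom 1 w ≡ S
      lastNoPeak w len eq with peaksFrom 1 w | peaks-before-end 1 w
      lastNoPeak w len refl | _ | _ ∷ m<end ∷ [] =
        <-irrefl refl (≤-trans (subst (λ x → suc (suc (4 + a)) ≤ x + 1) len m<end) (≤-reflexive (+-comm (4 + a) 1)))

    -- The maximum on the first peak: one letter before it, the rest has the single peak m.
    maxOnFirstPeak : ℕ → ℕ → ℕ
    maxOnFirstPeak f k = binom (suc k) 1 * (peakCount f 1 1 [] * (1 * peakCount f k 3 (4 + a ∷ [])))

    -- The maximum on the second peak: the letters before it have the single peak 2, those after it none.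
    maxOnSecondPeak : ℕ → ℕ → ℕ
    maxOnSecondPeak f k = binom (suc k) (3 + a) * (peakCount f (3 + a) 1 (2 ∷ []) * (1 * peakCount f (k ∸ (2 + a)) (5 + a) []))

    -- In the interior, the maximum must sit on one of the two peaks.
    interior : ∀ f k → 2 + a < k → ∑< k (λ i → maxTerm f (suc k) 1 S (suc i)) ≡ maxOnFirstPeak f k + maxOnSecondPeak f k
    interior f k 2+a<k = begin
        ∑< k (λ i → maxTerm f (suc k) 1 S (suc i))
      ≡⟨ ∑<-cong k atI ⟩
        ∑< k (λ i → 𝟙 (i ≡ᵇ 0) * maxOnFirstPeak f k + 𝟙 (i ≡ᵇ (2 + a)) * maxOnSecondPeak f k)
      ≡⟨ ∑<-+ k _ _ ⟩
        ∑< k (λ i → 𝟙 (i ≡ᵇ 0) * maxOnFirstPeak f k) + ∑< k (λ i → 𝟙 (i ≡ᵇ (2 + a)) * maxOnSecondPeak f k)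
      ≡⟨ cong₂ _+_ (trans (∑<-single k 0 _) (𝟙-true (<⇒<ᵇ-true 0 k (≤-trans (s≤s z≤n) 2+a<k))))
                   (trans (∑<-single k (2 + a) _) (𝟙-true (<⇒<ᵇ-true (2 + a) k 2+a<k))) ⟩
        maxOnFirstPeak f k + maxOnSecondPeak f k
      ∎
      where
      open ≡-Reasoning
      𝟙-true : ∀ {b V} → b ≡ true → 𝟙 b * V ≡ V
      𝟙-true refl = +-identityʳ _
      atI : ∀ i → i < k → maxTerm f (suc k) 1 S (suc i) ≡ 𝟙 (i ≡ᵇ 0) * maxOnFirstPeak f k + 𝟙 (i ≡ᵇ (2 + a)) * maxOnSecondPeak f k
      atI zero    i<k rewrite <⇒<ᵇ-true 0 k i<k = sym (trans (+-identityʳ _) (+-identityʳ _))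
      atI (suc i) i<k rewrite <⇒<ᵇ-true (suc i) k i<k | +-comm i 1 with suc a <ᵇ i in a+1<ᵇi
      ... | true rewrite ≢⇒≡ᵇ-false i (suc a) (λ i≡a+1 → <-irrefl (sym i≡a+1) (<ᵇ-true⇒< (suc a) i a+1<ᵇi)) =
        zeroʳ-by (binom (suc k) (suc (suc i))) (*-zeroʳ (peakCount f (suc (suc i)) 1 S))
      ... | false with i ≡ᵇ suc a in i≡ᵇa+1
      ...   | true with refl ← ≡ᵇ-true⇒≡ i (suc a) i≡ᵇa+1 = sym (+-identityʳ _)
      ...   | false = zeroʳ-by (binom (suc k) (suc (suc i))) (*-zeroʳ (peakCount f (suc (suc i)) 1 (2 ∷ [])))

    m<k+2 : ∀ k → 2 + a < k → 4 + a < suc k + 1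
    m<k+2 k 2+a<k = s≤s (≤-trans (s≤s 2+a<k) (≤-reflexive (+-comm 1 k)))

    maxLast : ∀ f k → 2 + a < k → maxTerm f (suc k) 1 S (suc k) ≡ peakCount f (suc k) 1 S
    maxLast f k 2+a<k rewrite below-S (suc k + 1) (m<k+2 k 2+a<k) | fromPos-S (suc k + 1) (m<k+2 k 2+a<k)
                            | ≥⇒<ᵇ-false k k ≤-refl | n∸n≡0 k | binom-diag (suc k) = trans (+-identityʳ _) (*-identityʳ _)

    -- The closed form, stated without subtraction:
    -- #P({2,m}; m+e) + (m+e-2) 2^(m+e-3) = ((m-3) C(m+e-2, m-1) + (m-2) C(m+e-2, m-2)) 2^(m+e-3).
    ClosedForm : ℕ → ℕ → Set
    ClosedForm f e = peakCount f (4 + e + a) 1 S + (2 + e + a) * 2 ^ (1 + e + a)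
                     ≡ ((1 + a) * binom (2 + e + a) (3 + a) + (2 + a) * binom (2 + e + a) (2 + a)) * 2 ^ (1 + e + a)

    module Step (f e : ℕ) (n≤f : 4 + e + a ≤ f) where

      k N X : ℕ
      k = 3 + e + a
      N = 2 + e + a
      X = 2 ^ (1 + e + a)

      a₀ b₀ c₀ : ℕ
      a₀ = binom N (1 + a)
      b₀ = binom N (2 + a)
      c₀ = binom N (3 + a)

      -- the counts of the pieces: single peak m after the first peak, single peak 2 before the second
      cq c₂ Z : ℕ
      cq = peakCount f k 3 (4 + a ∷ [])
      c₂ = peakCount f (3 + a) 1 (2 ∷ [])
      Z  = c₂ * 2 ^ e

      k≤f : k ≤ f
      k≤f = ≤-trans (n≤1+n k) n≤f

      2+a<k : 2 + a < k
      2+a<k = s≤s (s≤s (s≤s (m≤n+m a e)))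

      maxFirst : maxTerm f (suc k) 1 S 0 ≡ 0
      maxFirst = trans (*-identityˡ _) (trans (*-identityˡ _) (peakCount-early f (suc k) 2 2 (4 + a ∷ []) n≤f ≤-refl))

      onFirst : maxOnFirstPeak f k ≡ suc (suc N) * cq
      onFirst = cong₂ _*_ (binom-1 (suc k))
        (trans (cong (_* (1 * cq)) (peakCount-no-peaks f 1 1 (≤-trans (s≤s z≤n) k≤f))) (trans (*-identityˡ _) (*-identityˡ _)))

      onSecond : maxOnSecondPeak f k ≡ (a₀ + b₀ + (b₀ + c₀)) * Z
      onSecond = cong ((a₀ + b₀ + (b₀ + c₀)) *_) (cong (c₂ *_) (trans (*-identityˡ _)
        (trans (peakCount-no-peaks f (k ∸ (2 + a)) (5 + a) (≤-trans (m∸n≤m k (2 + a)) k≤f)) (cong noPeakCount (m+n∸n≡m (suc e) a)))))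

      countFirst : cq + X * 1 ≡ X * a₀
      countFirst = subst (λ b → cq + X * 𝟙 b ≡ X * a₀) (<⇒<ᵇ-true (suc a) (suc N) (s≤s (s≤s (≤-trans (n≤1+n a) (s≤s (m≤n+m a e))))))
                         (peakCount-one-peak f k 3 (suc a) k≤f)

      countSecond : Z + X ≡ X * (2 + a)
      countSecond = begin
          c₂ * 2 ^ e + X
        ≡⟨ cong (c₂ * 2 ^ e +_) (sym Y*2^e) ⟩
          c₂ * 2 ^ e + Y * 2 ^ e
        ≡⟨ sym (*-distribʳ-+ (2 ^ e) c₂ Y) ⟩
          (c₂ + Y) * 2 ^ e
        ≡⟨ cong (λ x → (c₂ + x) * 2 ^ e) (sym (*-identityʳ Y)) ⟩
          (c₂ + Y * 1) * 2 ^ e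
        ≡⟨ cong (_* 2 ^ e) (trans (peakCount-one-peak f (3 + a) 1 1 (≤-trans (s≤s (s≤s (s≤s (m≤n+m a e)))) k≤f))
                                  (cong (Y *_) (binom-1 (2 + a)))) ⟩
          Y * (2 + a) * 2 ^ e
        ≡⟨ *-right-swap Y (2 + a) (2 ^ e) ⟩
          Y * 2 ^ e * (2 + a)
        ≡⟨ cong (_* (2 + a)) Y*2^e ⟩
          X * (2 + a)
        ∎
        where
        open ≡-Reasoning
        Y : ℕ
        Y = 2 ^ (1 + a)
        Y*2^e : Y * 2 ^ e ≡ X
        Y*2^e = trans (sym (^-distribˡ-+-* 2 (1 + a) e)) (cong (λ x → 2 ^ suc x) (+-comm a e))

      next : ClosedForm f e → ClosedForm (suc f) (suc e)
      next countLast = begin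
          peakCount (suc f) (suc (suc k)) 1 S + suc N * (2 * X)
        ≡⟨ cong (_+ suc N * (2 * X)) (peakCount-unfold f k 1 S) ⟩
          maxTerm f (suc k) 1 S 0 + ∑< k (λ i → maxTerm f (suc k) 1 S (suc i)) + maxTerm f (suc k) 1 S (suc k) + suc N * (2 * X)
        ≡⟨ cong (_+ suc N * (2 * X)) (cong₂ _+_ (cong₂ _+_ maxFirst (interior f k 2+a<k)) (maxLast f k 2+a<k)) ⟩
          0 + (maxOnFirstPeak f k + maxOnSecondPeak f k) + peakCount f (suc k) 1 S + suc N * (2 * X)
        ≡⟨ cong (λ x → x + peakCount f (suc k) 1 S + suc N * (2 * X)) (cong₂ _+_ onFirst onSecond) ⟩
          suc (suc N) * cq + (a₀ + b₀ + (b₀ + c₀)) * Z + peakCount f (suc k) 1 S + suc N * (2 * X)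
        ≡⟨ twoPeaks-arith a e X a₀ b₀ c₀ cq Z _ countFirst countSecond countLast (binom-absorption N (suc a)) ⟩
          (suc a * (b₀ + c₀) + (2 + a) * (a₀ + b₀)) * (2 * X)
        ∎
        where open ≡-Reasoning

    -- Induction on the excess e = n - m; for e = 0 the count vanishes by `too-short`.
    closedForm : ∀ f e → 4 + e + a ≤ f → ClosedForm f e
    closedForm f zero m≤f = begin
        peakCount f (4 + a) 1 S + (2 + a) * 2 ^ (1 + a)
      ≡⟨ cong (_+ (2 + a) * 2 ^ (1 + a)) (too-short f m≤f) ⟩
        (2 + a) * 2 ^ (1 + a)
      ≡⟨ cong (_* 2 ^ (1 + a)) (sym (*-identityʳ (2 + a))) ⟩
        (0 + (2 + a) * 1) * 2 ^ (1 + a)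
      ≡⟨ cong₂ (λ x y → (x + (2 + a) * y) * 2 ^ (1 + a))
               (sym (zeroʳ-by (1 + a) (binom-> (2 + a) (3 + a) ≤-refl))) (sym (binom-diag (2 + a))) ⟩
        ((1 + a) * binom (2 + a) (3 + a) + (2 + a) * binom (2 + a) (2 + a)) * 2 ^ (1 + a)
      ∎
      where open ≡-Reasoning
    closedForm zero    (suc e) ()
    closedForm (suc f) (suc e) (s≤s n≤f) = Step.next f e n≤f (closedForm f e n≤f)

  ∑-filter : {X : Set} {P : X → Set} (P? : Decidable P) (xs : List X) (f : X → ℕ) →
    ∑ (filter P? xs) f ≡ ∑ xs (λ x → 𝟙 (does (P? x)) * f x)
  ∑-filter P? []       f = refl
  ∑-filter P? (x ∷ xs) f with does (P? x)
  ... | false = ∑-filter P? xs f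
  ... | true  = cong₂ _+_ (sym (+-identityʳ (f x))) (∑-filter P? xs f)

  length-as-∑ : {X : Set} (xs : List X) → length xs ≡ ∑ xs (λ _ → 1)
  length-as-∑ []       = refl
  length-as-∑ (x ∷ xs) = cong suc (length-as-∑ xs)

  avoids : List ℕ → List ℕ → Bool
  avoids u []      = true
  avoids u (x ∷ w) = not (x ∈ᵇ u) ∧ avoids u w

  notIn : ℕ → List ℕ → Bool
  notIn a w = does (all? (λ y → ¬? (a ≟ y)) w)

  avoids-∷ : ∀ a u w → notIn a w ∧ avoids u w ≡ avoids (a ∷ u) w
  avoids-∷ a u []      = refl
  avoids-∷ a u (y ∷ w) rewrite ≡ᵇ-sym y a with a ≡ᵇ y
  ... | true  = refl
  ... | false = trans (swap (notIn a w) (not (y ∈ᵇ u)) (avoids u w)) (cong (not (y ∈ᵇ u) ∧_) (avoids-∷ a u w))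
    where
    swap : ∀ p q r → p ∧ (q ∧ r) ≡ q ∧ (p ∧ r)
    swap true  q     r = refl
    swap false true  r = refl
    swap false false r = refl

  unique-avoids≡fresh : ∀ u w → does (unique? w) ∧ avoids u w ≡ fresh u w
  unique-avoids≡fresh u []      = refl
  unique-avoids≡fresh u (a ∷ w) =
    trans (regroup (notIn a w) (does (unique? w)) (not (a ∈ᵇ u)) (avoids u w))
          (cong (not (a ∈ᵇ u) ∧_) (trans (cong (does (unique? w) ∧_) (avoids-∷ a u w)) (unique-avoids≡fresh (a ∷ u) w)))
    where
    regroup : ∀ p q r s → (p ∧ q) ∧ (r ∧ s) ≡ r ∧ (q ∧ (p ∧ s))
    regroup true  true  r     s = refl
    regroup true  false true  s = refl
    regroup true  false false s = refl
    regroup false true  true  s = refl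
    regroup false false true  s = refl
    regroup false q     false s = refl

  avoids-[] : ∀ w → avoids [] w ≡ true
  avoids-[] []      = refl
  avoids-[] (x ∷ w) = avoids-[] w

  unique≡fresh : ∀ w → does (unique? w) ≡ fresh [] w
  unique≡fresh w = trans (sym (∧-identityʳ _)) (trans (cong (does (unique? w) ∧_) (sym (avoids-[] w))) (unique-avoids≡fresh [] w))

  countPeakSet≡peakCount : ∀ S n → countPeakSet S n ≡ peakCount n n 1 S
  countPeakSet≡peakCount S n = begin
      countPeakSet S n
    ≡⟨ length-as-∑ (filter hasPeaks? (filter unique? (words n n))) ⟩
      ∑ (filter hasPeaks? (filter unique? (words n n))) (λ _ → 1)
    ≡⟨ ∑-filter hasPeaks? (filter unique? (words n n)) _ ⟩
      ∑ (filter unique? (words n n)) (λ w → 𝟙 (eqList (peakSet w) S) * 1)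
    ≡⟨ ∑-filter unique? (words n n) _ ⟩
      ∑ (words n n) (λ w → 𝟙 (does (unique? w)) * (𝟙 (eqList (peakSet w) S) * 1))
    ≡⟨ ∑-cong (words n n) (λ w → cong₂ _*_ (cong 𝟙 (unique≡fresh w)) (*-identityʳ _)) ⟩
      #freshPeak n [] n 1 S
    ≡⟨ peakCount-counts-permutations n n 1 S ≤-refl ⟩
      peakCount n n 1 S
    ∎
    where
    open ≡-Reasoning
    hasPeaks? : Decidable (λ w → peakSet w ≡ S)
    hasPeaks? w = ≡-dec _≟_ (peakSet w) S

  -- The theorem over ℕ, for m = 4 + a and n = m + e, with the negative term moved across.
  twoPeaks-count : ∀ a e →
    countPeakSet (2 ∷ 4 + a ∷ []) (4 + e + a) + ((2 + e + a) C 1) * 2 ^ (1 + e + a)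
      ≡ ((1 + a) * ((2 + e + a) C (3 + a)) + (2 + a) * ((2 + e + a) C (2 + a))) * 2 ^ (1 + e + a)
  twoPeaks-count a e = begin
      countPeakSet S (4 + e + a) + (B C 1) * X
    ≡⟨ cong₂ (λ x y → x + y * X) (countPeakSet≡peakCount S (4 + e + a)) (nC1≡n B) ⟩
      peakCount (4 + e + a) (4 + e + a) 1 S + B * X
    ≡⟨ TwoPeaks.closedForm a (4 + e + a) e ≤-refl ⟩
      ((1 + a) * binom B (3 + a) + (2 + a) * binom B (2 + a)) * X
    ≡⟨ cong₂ (λ x y → ((1 + a) * x + (2 + a) * y) * X) (binom≡C B (3 + a)) (binom≡C B (2 + a)) ⟩
      ((1 + a) * (B C (3 + a)) + (2 + a) * (B C (2 + a))) * X
    ∎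
    where
    open ≡-Reasoning
    S : List ℕ
    S = 2 ∷ 4 + a ∷ []
    B X : ℕ
    B = 2 + e + a
    X = 2 ^ (1 + e + a)

  ℕ-identity-to-ℤ : ∀ c p q r t B X → c + B * X ≡ (p * q + r * t) * X →
    toℤ c ≡ (toℤ p *ℤ toℤ q +ℤ toℤ r *ℤ toℤ t -ℤ toℤ B) *ℤ toℤ X
  ℕ-identity-to-ℤ c p q r t B X eq = begin
      toℤ c
    ≡⟨ add-sub (toℤ c) (toℤ (B * X)) ⟩
      toℤ c +ℤ toℤ (B * X) -ℤ toℤ (B * X)
    ≡⟨ cong₂ _-ℤ_ (sym (pos-+ c (B * X))) (pos-* B X) ⟩
      toℤ (c + B * X) -ℤ toℤ B *ℤ toℤ X
    ≡⟨ cong (λ x → toℤ x -ℤ toℤ B *ℤ toℤ X) eq ⟩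
      toℤ ((p * q + r * t) * X) -ℤ toℤ B *ℤ toℤ X
    ≡⟨ cong (_-ℤ toℤ B *ℤ toℤ X) (trans (pos-* (p * q + r * t) X)
                                    (cong (_*ℤ toℤ X) (trans (pos-+ (p * q) (r * t)) (cong₂ _+ℤ_ (pos-* p q) (pos-* r t))))) ⟩
      (toℤ p *ℤ toℤ q +ℤ toℤ r *ℤ toℤ t) *ℤ toℤ X -ℤ toℤ B *ℤ toℤ X
    ≡⟨ factor (toℤ p) (toℤ q) (toℤ r) (toℤ t) (toℤ B) (toℤ X) ⟩
      (toℤ p *ℤ toℤ q +ℤ toℤ r *ℤ toℤ t -ℤ toℤ B) *ℤ toℤ X
    ∎
    where
    open ≡-Reasoning
    add-sub : ∀ (x y : ℤ) → x ≡ x +ℤ y -ℤ y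
    add-sub = ℤ-solve-∀
    factor : ∀ (P Q R T B X : ℤ) → (P *ℤ Q +ℤ R *ℤ T) *ℤ X -ℤ B *ℤ X ≡ (P *ℤ Q +ℤ R *ℤ T -ℤ B) *ℤ X
    factor = ℤ-solve-∀

  twoPeaks-count-ℤ : ∀ a e →
    toℤ (countPeakSet (2 ∷ 4 + a ∷ []) (4 + e + a))
      ≡ (toℤ (1 + a) *ℤ toℤ ((2 + e + a) C (3 + a)) +ℤ toℤ (2 + a) *ℤ toℤ ((2 + e + a) C (2 + a))
         -ℤ toℤ ((2 + e + a) C 1)) *ℤ toℤ (2 ^ (1 + e + a))
  twoPeaks-count-ℤ a e =
    ℕ-identity-to-ℤ _ (1 + a) ((2 + e + a) C (3 + a)) (2 + a) ((2 + e + a) C (2 + a)) ((2 + e + a) C 1) (2 ^ (1 + e + a))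
                    (twoPeaks-count a e)

  excess : ∀ a n → suc (4 + a) ≤ n → Σ ℕ (λ e → 4 + e + a ≡ n)
  excess a n m<n = n ∸ (4 + a) , trans (cong (4 +_) (+-comm (n ∸ (4 + a)) a)) (m+[n∸m]≡n (≤-trans (n≤1+n (4 + a)) m<n))

open import Defs
open import Data.Nat using (ℕ; _≤_; _∸_; _^_; suc)
open import Data.Nat.Combinatorics using (_C_)
open import Data.Integer using (ℤ; +_; _+_; _-_; _*_)
open import Data.List using (_∷_; [])
open import Relation.Binary.PropositionalEquality using (_≡_)

open import Data.Nat using (s≤s; z≤n)
open import Data.Product using (_,_)
open import Relation.Binary.PropositionalEquality using (refl)
open PeakCounting using (twoPeaks-count-ℤ; excess)

theorem3p2 : (m n : ℕ) → 4 ≤ m → suc m ≤ n →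
    + countPeakSet (2 ∷ m ∷ []) n
    ≡ (+ (m ∸ 3) * + ((n ∸ 2) C (m ∸ 1)) + + (m ∸ 2) * + ((n ∸ 2) C (m ∸ 2))
    - + ((n ∸ 2) C 1)) * + (2 ^ (n ∸ 3))
theorem3p2 (suc (suc (suc (suc a)))) n (s≤s (s≤s (s≤s (s≤s z≤n)))) m<n with excess a n m<n
... | e , refl = twoPeaks-count-ℤ a e
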